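{- Let $k\geq 2$ be an integer. Call a word $w=w_1\cdots w_n\in[k]^n$ (where $[k]=\{1,\ldots,k\}$) cyclic Hertzsprung if there is no $0\leq i\leq n-1$ with $|w_{i+1}-w_i|\leq 1$, where $w_0$ means $w_n$. Let $\psi=-\frac{1+x}{2x}$ and \[\gamma(x,0)=\frac{k}{1+3x}+\frac{2x}{(1+3x)^{2}}\cdot\frac{U_{k}(\psi)-U_{k-1}(\psi)-1}{U_{k}(\psi)}.\] Then the generating function $\sum_{n\geq 0} c_n x^n$, where $c_n$ is the number of cyclic Hertzsprung words in $[k]^n$, equals \[1+\frac{1-3x}{(1+3x)(1-x)}\left[\frac{1}{1-x\gamma(x,0)}+\frac{2x(k+1)}{(1-3x)U_{k}(\psi)}\left(\frac{1-x\,\frac{1+k-U_{k}(\psi)}{1+3x}}{1-x\gamma(x,0)}+U_{k-1}(\psi)-1\right)-kx-1\right].\]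
   Context: $U_n(y)$ denotes the Chebyshev polynomial of the second kind, defined by $U_0(y)=1$, $U_1(y)=2y$, $U_{n+1}(y)=2yU_n(y)-U_{n-1}(y)$. The empty word counts as cyclic Hertzsprung; a word of length $1$ is never cyclic Hertzsprung (since $w_0=w_1$). -}

module Defs where

open import Data.Nat as ℕ using (ℕ; zero; suc; _≤_; _≤?_; ∣_-_∣)
open import Data.Integer as ℤ using (ℤ; +_; -_)
open import Data.Fin using (Fin; toℕ)
open import Data.List as List using (List; []; _∷_; concatMap; map; filter; length)
open import Data.List.Base using (allFin)
open import Data.Vec as Vec using (Vec; []; _∷_; _∷ʳ_; zip)
open import Data.Vec.Relation.Unary.All using (All; all?)
open import Data.Product using (_×_; _,_; proj₁; proj₂; ∃)
open import Relation.Nullary using (¬_; ¬?)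
open import Relation.Binary.PropositionalEquality using (_≡_; _≢_)

-- Words and the cyclic Hertzsprung property
-- A word w₁⋯wₙ ∈ [k]ⁿ is a vector of length n over Fin k
-- (letter j+1 of [k] is represented by j : Fin k; only differences matter).

rotate : ∀ {A : Set} {n} → Vec A n → Vec A n
rotate []       = []
rotate (x ∷ xs) = xs ∷ʳ x

Good : ∀ {k} → Fin k × Fin k → Set
Good (a , b) = ¬ (∣ toℕ a - toℕ b ∣ ≤ 1)

good? : ∀ {k} (p : Fin k × Fin k) → Relation.Nullary.Dec (Good p)
good? (a , b) = ¬? (∣ toℕ a - toℕ b ∣ ≤? 1)

CyclicHertzsprung : ∀ {k n} → Vec (Fin k) n → Set
CyclicHertzsprung w = All Good (zip w (rotate w))

cyclicHertzsprung? : ∀ {k n} (w : Vec (Fin k) n) → Relation.Nullary.Dec (CyclicHertzsprung w)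
cyclicHertzsprung? w = all? good? (zip w (rotate w))

words : (k n : ℕ) → List (Vec (Fin k) n)
words k zero    = [] ∷ []
words k (suc n) = concatMap (λ a → map (a ∷_) (words k n)) (allFin k)

c : (k n : ℕ) → ℕ
c k n = length (filter cyclicHertzsprung? (words k n))

Series : Set
Series = ℕ → ℤ

sumUpTo : (ℕ → ℤ) → ℕ → ℤ
sumUpTo f zero    = f zero
sumUpTo f (suc n) = sumUpTo f n ℤ.+ f (suc n)

_⊕_ : Series → Series → Series
(f ⊕ g) n = f n ℤ.+ g n

⊖_ : Series → Series
(⊖ f) n = ℤ.- f n

_⊗_ : Series → Series → Series
(f ⊗ g) n = sumUpTo (λ i → f i ℤ.* g (n ℕ.∸ i)) n

const : ℤ → Series
const a zero    = a
const a (suc n) = + 0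

X : Series
X 1 = + 1
X _ = + 0

-- Field of fractions of ℤ[[x]]: a pair (N , D) stands for N / D.

Frac : Set
Frac = Series × Series

num den : Frac → Series
num = proj₁
den = proj₂

ser : Series → Frac
ser f = f , const (+ 1)

int : ℤ → Frac
int a = ser (const a)

nat : ℕ → Frac
nat n = int (+ n)

x : Frac
x = ser X

infixl 6 _+F_ _-F_
infixl 7 _*F_ _/F_

_+F_ : Frac → Frac → Frac
(a , b) +F (c' , d) = (a ⊗ d) ⊕ (c' ⊗ b) , b ⊗ d

-F_ : Frac → Frac
-F (a , b) = ⊖ a , b

_-F_ : Frac → Frac → Frac
p -F q = p +F (-F q)

_*F_ : Frac → Frac → Frac
(a , b) *F (c' , d) = a ⊗ c' , b ⊗ d

_/F_ : Frac → Frac → Frac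
(a , b) /F (c' , d) = a ⊗ d , b ⊗ c'

chebU : ℕ → Frac → Frac
chebU zero          y = nat 1
chebU (suc zero)    y = nat 2 *F y
chebU (suc (suc n)) y = nat 2 *F y *F chebU (suc n) y -F chebU n y

-- "the series s equals (as an element of the fraction field of ℤ[[x]])
--  the fraction r": the denominator is a nonzero series and s · D = N.
_equalsFrac_ : Series → Frac → Set
s equalsFrac r = (∃ λ n → den r n ≢ + 0) × (∀ n → (s ⊗ den r) n ≡ num r n)

module _ (k : ℕ) where
  ψ : Frac
  ψ = -F ((nat 1 +F x) /F (nat 2 *F x))

  Uk Uk-1 : Frac
  Uk   = chebU k ψ
  Uk-1 = chebU (k ℕ.∸ 1) ψ

  1+3x 1-3x 1-x : Frac
  1+3x = nat 1 +F nat 3 *F x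
  1-3x = nat 1 -F nat 3 *F x
  1-x  = nat 1 -F x

  γ : Frac
  γ = nat k /F 1+3x
      +F (nat 2 *F x) /F (1+3x *F 1+3x) *F ((Uk -F Uk-1 -F nat 1) /F Uk)

  RHS : Frac
  RHS = nat 1 +F (1-3x /F (1+3x *F 1-x)) *F
        ( nat 1 /F (nat 1 -F x *F γ)
          +F (nat 2 *F x *F nat (suc k)) /F (1-3x *F Uk) *F
             ( (nat 1 -F x *F ((nat 1 +F nat k -F Uk) /F 1+3x)) /F (nat 1 -F x *F γ)
               +F Uk-1 -F nat 1 )
          -F nat k *F x -F nat 1 )

cyclicGF : ℕ → Series
cyclicGF k n = + (c k n)

-- Let A be the k × k matrix with A a b = 1 if |a - b| ≥ 2 and 0 otherwise. A nonempty cyclic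
-- Hertzsprung word of length n is a closed walk of length n in A, so Σ cₙ xⁿ = 1 - k + tr N with
-- N = (I - xA)⁻¹ over ℤ[[x]]. As A = 𝟙𝟙ᵀ - (I + S + Sᵀ) for the shift S, I - xA = M - x𝟙𝟙ᵀ with
-- M = (1 + x) I + x (S + Sᵀ) tridiagonal. The entries of M⁻¹ are products of solutions of
-- vₙ₊₂ = (1 + x) vₙ₊₁ - x² vₙ, where vₙ₊₁ = (-x)ⁿ Uₙ(ψ), and Sherman–Morrison gives
-- tr N = tr M⁻¹ + x ‖M⁻¹𝟙‖² / (1 - x γ) with γ = 𝟙ᵀ M⁻¹ 𝟙 = γ(x, 0). The sums over entries of M⁻¹
-- that occur have closed forms in v_k and v_{k+1}, and the stated fraction then follows from a
-- polynomial identity modulo Cassini's identity for v. No inverse is ever formed: every relation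
-- is multiplied out, and nonzero factors are cancelled at the end.

module Submission where

open import Defs
open import Data.Nat using (ℕ; _≤_)

open import Algebra.Bundles using (CommutativeRing)
open import Algebra.Structures using (IsCommutativeRing)
open import Algebra.Solver.Ring.AlmostCommutativeRing using (_-Raw-AlmostCommutative⟶_; fromCommutativeRing)
import Algebra.Solver.Ring
open import Data.Bool using (Bool; T; true; false; not; _∧_; if_then_else_)
import Data.Bool.Properties as Boolₚ
open import Data.Empty using (⊥-elim)
open import Data.Fin using (Fin; toℕ; #_) renaming (zero to fzero; suc to fsuc)
open import Data.Integer as ℤ using (ℤ; +_)
import Data.Integer.Properties as ℤₚ
open import Data.Integer.Solver using (module +-*-Solver)
open import Data.List as List using (List; []; _∷_; _++_; map; filter; length; concat; concatMap; tabulate)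
open import Data.Maybe using (Maybe; just; nothing)
open import Data.Nat as ℕ using (zero; suc; pred; _∸_)
open import Data.Nat.ListAction using (sum)
import Data.Nat.Properties as ℕₚ
open import Data.Product using (∃; _×_; _,_; proj₁; proj₂)
open import Data.Sum using (inj₁; inj₂; [_,_]′)
open import Data.Vec as Vec using (Vec; []; _∷_; _∷ʳ_; zip)
open import Data.Vec.Relation.Unary.All using (All; all?)
open import Function using (case_of_)
open import Relation.Binary.Definitions using (tri<; tri≈; tri>)
open import Relation.Binary.PropositionalEquality using (_≡_; _≢_; refl; sym; trans; cong; cong₂; subst; module ≡-Reasoning)
import Relation.Binary.Reasoning.Setoid as SetoidReasoning
open import Relation.Nullary using (Dec; does; yes; no)

open import Algebra.Properties.CommutativeSemigroup ℤₚ.+-commutativeSemigroup using (interchange)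

infix 4 _≈_
record _≈_ (f g : Series) : Set where
  constructor coeffwise
  field coeff : ∀ n → f n ≡ g n
open _≈_

shift : Series → Series
shift f n = f (suc n)

sumUpTo-cong : ∀ {f g : ℕ → ℤ} n → (∀ i → i ℕ.≤ n → f i ≡ g i) → sumUpTo f n ≡ sumUpTo g n
sumUpTo-cong zero    f≡g = f≡g zero ℕ.z≤n
sumUpTo-cong (suc n) f≡g =
  cong₂ ℤ._+_ (sumUpTo-cong n λ i i≤n → f≡g i (ℕₚ.m≤n⇒m≤1+n i≤n)) (f≡g (suc n) ℕₚ.≤-refl)

sumUpTo-zero : ∀ (f : ℕ → ℤ) n → (∀ i → f i ≡ + 0) → sumUpTo f n ≡ + 0
sumUpTo-zero f zero    f≡0 = f≡0 zero
sumUpTo-zero f (suc n) f≡0 rewrite sumUpTo-zero f n f≡0 | f≡0 (suc n) = refl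

sumUpTo-+ : ∀ (f g : ℕ → ℤ) n → sumUpTo (λ i → f i ℤ.+ g i) n ≡ sumUpTo f n ℤ.+ sumUpTo g n
sumUpTo-+ f g zero    = refl
sumUpTo-+ f g (suc n) rewrite sumUpTo-+ f g n =
  interchange (sumUpTo f n) (sumUpTo g n) (f (suc n)) (g (suc n))

sumUpTo-*ˡ : ∀ c (f : ℕ → ℤ) n → sumUpTo (λ i → c ℤ.* f i) n ≡ c ℤ.* sumUpTo f n
sumUpTo-*ˡ c f zero    = refl
sumUpTo-*ˡ c f (suc n) rewrite sumUpTo-*ˡ c f n = sym (ℤₚ.*-distribˡ-+ c (sumUpTo f n) (f (suc n)))

sumUpTo-suc : ∀ (f : ℕ → ℤ) n → sumUpTo f (suc n) ≡ f zero ℤ.+ sumUpTo (λ i → f (suc i)) n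
sumUpTo-suc f zero    = refl
sumUpTo-suc f (suc n) rewrite sumUpTo-suc f n = ℤₚ.+-assoc (f zero) _ _

sumUpTo-reverse : ∀ (f : ℕ → ℤ) n → sumUpTo f n ≡ sumUpTo (λ i → f (n ∸ i)) n
sumUpTo-reverse f zero    = refl
sumUpTo-reverse f (suc n) = begin
  sumUpTo f n ℤ.+ f (suc n)                       ≡⟨ cong (ℤ._+ f (suc n)) (sumUpTo-reverse f n) ⟩
  sumUpTo (λ i → f (n ∸ i)) n ℤ.+ f (suc n)       ≡⟨ ℤₚ.+-comm _ (f (suc n)) ⟩
  f (suc n) ℤ.+ sumUpTo (λ i → f (n ∸ i)) n       ≡⟨ sumUpTo-suc (λ i → f (suc n ∸ i)) n ⟨
  sumUpTo (λ i → f (suc n ∸ i)) (suc n)           ∎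
  where open ≡-Reasoning

⊗-suc : ∀ f g n → (f ⊗ g) (suc n) ≡ f zero ℤ.* g (suc n) ℤ.+ (shift f ⊗ g) n
⊗-suc f g n = sumUpTo-suc (λ i → f i ℤ.* g (suc n ∸ i)) n

≈-refl : ∀ {f} → f ≈ f
≈-refl = coeffwise λ _ → refl

≈-sym : ∀ {f g} → f ≈ g → g ≈ f
≈-sym f≈g = coeffwise λ n → sym (coeff f≈g n)

≈-trans : ∀ {f g h} → f ≈ g → g ≈ h → f ≈ h
≈-trans f≈g g≈h = coeffwise λ n → trans (coeff f≈g n) (coeff g≈h n)

⊕-cong : ∀ {f f′ g g′} → f ≈ f′ → g ≈ g′ → f ⊕ g ≈ f′ ⊕ g′
⊕-cong f≈ g≈ = coeffwise λ n → cong₂ ℤ._+_ (coeff f≈ n) (coeff g≈ n)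

⊖-cong : ∀ {f f′} → f ≈ f′ → ⊖ f ≈ ⊖ f′
⊖-cong f≈ = coeffwise λ n → cong ℤ.-_ (coeff f≈ n)

⊗-cong : ∀ {f f′ g g′} → f ≈ f′ → g ≈ g′ → f ⊗ g ≈ f′ ⊗ g′
⊗-cong f≈ g≈ = coeffwise λ n →
  sumUpTo-cong n λ i _ → cong₂ ℤ._*_ (coeff f≈ i) (coeff g≈ (n ∸ i))

⊗-distribˡ-⊕ : ∀ h f g → h ⊗ (f ⊕ g) ≈ (h ⊗ f) ⊕ (h ⊗ g)
⊗-distribˡ-⊕ h f g = coeffwise λ n →
  trans (sumUpTo-cong n λ i _ → ℤₚ.*-distribˡ-+ (h i) (f (n ∸ i)) (g (n ∸ i))) (sumUpTo-+ _ _ n)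

⊗-distribʳ-⊕ : ∀ h f g → (f ⊕ g) ⊗ h ≈ (f ⊗ h) ⊕ (g ⊗ h)
⊗-distribʳ-⊕ h f g = coeffwise λ n →
  trans (sumUpTo-cong n λ i _ → ℤₚ.*-distribʳ-+ (h (n ∸ i)) (f i) (g i)) (sumUpTo-+ _ _ n)

⊗-comm : ∀ f g → f ⊗ g ≈ g ⊗ f
⊗-comm f g = coeffwise λ n → trans (sumUpTo-reverse _ n) (sumUpTo-cong n λ i i≤n →
  trans (cong (λ j → f (n ∸ i) ℤ.* g j) (ℕₚ.m∸[m∸n]≡n i≤n)) (ℤₚ.*-comm (f (n ∸ i)) (g i)))

scale : ℤ → Series → Series
scale c f n = c ℤ.* f n

scale-⊗ : ∀ c f g → scale c f ⊗ g ≈ scale c (f ⊗ g)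
scale-⊗ c f g = coeffwise λ n →
  trans (sumUpTo-cong n λ i _ → ℤₚ.*-assoc c (f i) _) (sumUpTo-*ˡ c _ n)

shift-⊗ : ∀ f g → shift (f ⊗ g) ≈ scale (f zero) (shift g) ⊕ (shift f ⊗ g)
shift-⊗ f g = coeffwise (⊗-suc f g)

⊗-assoc : ∀ f g h → (f ⊗ g) ⊗ h ≈ f ⊗ (g ⊗ h)
⊗-assoc f g h = coeffwise λ n → assoc n f g h
  where
  open +-*-Solver
  assoc : ∀ n f g h → ((f ⊗ g) ⊗ h) n ≡ (f ⊗ (g ⊗ h)) n
  assoc zero    f g h = ℤₚ.*-assoc (f zero) (g zero) (h zero)
  assoc (suc n) f g h = begin
    ((f ⊗ g) ⊗ h) (suc n)
      ≡⟨ ⊗-suc (f ⊗ g) h n ⟩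
    (f₀ ℤ.* g₀) ℤ.* h (suc n) ℤ.+ (shift (f ⊗ g) ⊗ h) n
      ≡⟨ cong (ℤ._+_ (f₀ ℤ.* g₀ ℤ.* h (suc n))) (begin
           (shift (f ⊗ g) ⊗ h) n
             ≡⟨ coeff (⊗-cong (shift-⊗ f g) (≈-refl {h})) n ⟩
           ((scale f₀ (shift g) ⊕ (shift f ⊗ g)) ⊗ h) n
             ≡⟨ coeff (⊗-distribʳ-⊕ h (scale f₀ (shift g)) (shift f ⊗ g)) n ⟩
           (scale f₀ (shift g) ⊗ h) n ℤ.+ ((shift f ⊗ g) ⊗ h) n
             ≡⟨ cong₂ ℤ._+_ (coeff (scale-⊗ f₀ (shift g) h) n) (assoc n (shift f) g h) ⟩
           f₀ ℤ.* (shift g ⊗ h) n ℤ.+ (shift f ⊗ (g ⊗ h)) n ∎) ⟩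
    (f₀ ℤ.* g₀) ℤ.* h (suc n) ℤ.+ (f₀ ℤ.* (shift g ⊗ h) n ℤ.+ (shift f ⊗ (g ⊗ h)) n)
      ≡⟨ solve 5 (λ a b c d e → (a :* b) :* c :+ (a :* d :+ e) := a :* (b :* c :+ d) :+ e)
               refl f₀ g₀ (h (suc n)) ((shift g ⊗ h) n) ((shift f ⊗ (g ⊗ h)) n) ⟩
    f₀ ℤ.* (g₀ ℤ.* h (suc n) ℤ.+ (shift g ⊗ h) n) ℤ.+ (shift f ⊗ (g ⊗ h)) n
      ≡⟨ cong (λ t → f₀ ℤ.* t ℤ.+ (shift f ⊗ (g ⊗ h)) n) (⊗-suc g h n) ⟨
    f₀ ℤ.* (g ⊗ h) (suc n) ℤ.+ (shift f ⊗ (g ⊗ h)) n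
      ≡⟨ ⊗-suc f (g ⊗ h) n ⟨
    (f ⊗ (g ⊗ h)) (suc n) ∎
    where
    open ≡-Reasoning
    f₀ g₀ : ℤ
    f₀ = f zero
    g₀ = g zero

⊗-identityˡ : ∀ f → const (+ 1) ⊗ f ≈ f
⊗-identityˡ f = coeffwise λ
  { zero    → ℤₚ.*-identityˡ (f zero)
  ; (suc n) → trans (⊗-suc (const (+ 1)) f n)
                (trans (cong₂ ℤ._+_ (ℤₚ.*-identityˡ (f (suc n))) (sumUpTo-zero _ n λ _ → refl))
                       (ℤₚ.+-identityʳ (f (suc n)))) }

const0≡0 : ∀ n → const (+ 0) n ≡ + 0
const0≡0 zero    = refl
const0≡0 (suc n) = refl

-- The ring operations are opaque so that Agda can infer the operands of a sum or product from
-- its type: the coefficient (f ⊗ g) n unfolds into a sum in which g is hidden.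
infixl 6 _+_
infixl 7 _*_
infix  8 -_
opaque
  _+_ _*_ : Series → Series → Series
  f + g = f ⊕ g
  f * g = f ⊗ g

  -_ : Series → Series
  -_ = ⊖_

  +-coeff : ∀ f g n → (f + g) n ≡ f n ℤ.+ g n
  +-coeff f g n = refl

  *-coeff : ∀ f g n → (f * g) n ≡ (f ⊗ g) n
  *-coeff f g n = refl

  neg-coeff : ∀ f n → (- f) n ≡ ℤ.- f n
  neg-coeff f n = refl

  series-isCommutativeRing : IsCommutativeRing _≈_ _+_ _*_ -_ (const (+ 0)) (const (+ 1))
  series-isCommutativeRing = record
    { isRing = record
      { +-isAbelianGroup = record
        { isGroup = record
          { isMonoid = record
            { isSemigroup = record
              { isMagma = record
                { isEquivalence = record { refl = ≈-refl ; sym = ≈-sym ; trans = ≈-trans }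
                ; ∙-cong = ⊕-cong }
              ; assoc = λ f g h → coeffwise λ n → ℤₚ.+-assoc (f n) (g n) (h n) }
            ; identity = (λ (f : Series) → coeffwise (0+f f))
                       , (λ (f : Series) → coeffwise λ n → trans (ℤₚ.+-comm (f n) (const (+ 0) n)) (0+f f n)) }
          ; inverse = (λ (f : Series) → coeffwise λ n → trans (ℤₚ.+-inverseˡ (f n)) (sym (const0≡0 n)))
                    , (λ (f : Series) → coeffwise λ n → trans (ℤₚ.+-inverseʳ (f n)) (sym (const0≡0 n)))
          ; ⁻¹-cong = ⊖-cong }
        ; comm = λ f g → coeffwise λ n → ℤₚ.+-comm (f n) (g n) }
      ; *-cong = ⊗-cong
      ; *-assoc = ⊗-assoc
      ; *-identity = ⊗-identityˡ , (λ f → ≈-trans (⊗-comm f (const (+ 1))) (⊗-identityˡ f))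
      ; distrib = ⊗-distribˡ-⊕ , ⊗-distribʳ-⊕ }
    ; *-comm = ⊗-comm }
    where
    0+f : ∀ (f : Series) n → const (+ 0) n ℤ.+ f n ≡ f n
    0+f f n rewrite const0≡0 n = ℤₚ.+-identityˡ (f n)

seriesRing : CommutativeRing _ _
seriesRing = record { isCommutativeRing = series-isCommutativeRing }

const-homomorphism : CommutativeRing.rawRing ℤₚ.+-*-commutativeRing -Raw-AlmostCommutative⟶ fromCommutativeRing seriesRing
const-homomorphism = record
  { ⟦_⟧    = const
  ; +-homo = λ a b → coeffwise λ n → trans (+-at a b n) (sym (+-coeff (const a) (const b) n))
  ; *-homo = λ a b → coeffwise λ n → trans (*-at a b n) (sym (*-coeff (const a) (const b) n))
  ; -‿homo = λ a → coeffwise λ n → trans (neg-at a n) (sym (neg-coeff (const a) n))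
  ; 0-homo = coeffwise λ { zero → refl ; (suc n) → refl }
  ; 1-homo = coeffwise λ { zero → refl ; (suc n) → refl }
  }
  where
  +-at : ∀ a b n → const (a ℤ.+ b) n ≡ const a n ℤ.+ const b n
  +-at a b zero    = refl
  +-at a b (suc n) = refl
  neg-at : ∀ a n → const (ℤ.- a) n ≡ ℤ.- const a n
  neg-at a zero    = refl
  neg-at a (suc n) = refl
  *-at : ∀ a b n → const (a ℤ.* b) n ≡ (const a ⊗ const b) n
  *-at a b zero    = refl
  *-at a b (suc n) = sym (trans (⊗-suc (const a) (const b) n)
                       (cong₂ ℤ._+_ (ℤₚ.*-zeroʳ a) (sumUpTo-zero _ n λ _ → refl)))

const-≟ : ∀ a b → Maybe (const a ≈ const b)
const-≟ a b with a ℤₚ.≟ b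
... | yes refl = just ≈-refl
... | no _     = nothing

module SeriesSolver = Algebra.Solver.Ring (CommutativeRing.rawRing ℤₚ.+-*-commutativeRing)
                        (fromCommutativeRing seriesRing) const-homomorphism const-≟

const-+ : ∀ m n → const (+ (m ℕ.+ n)) ≈ const (+ m) + const (+ n)
const-+ m n = _-Raw-AlmostCommutative⟶_.+-homo const-homomorphism (+ m) (+ n)

open CommutativeRing seriesRing
  using ( _-_; 0#; 1#; +-cong; *-cong; -‿cong; +-identityˡ; +-identityʳ; zeroˡ; zeroʳ; +-assoc; +-comm
        ; distribˡ; distribʳ; *-comm; *-assoc; *-identityˡ; *-identityʳ; setoid)
open import Algebra.Properties.Semiring.Exp (CommutativeRing.semiring seriesRing)
  using (_^_; ^-homo-*; ^-congʳ)
open SeriesSolver using (Polynomial; var; con; _:+_; _:*_; _:-_; :-_; _:=_; solve; prove; ⟦_⟧; ⟦_⟧↓)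
module ≈-Reasoning = SetoidReasoning setoid
open import Algebra.Properties.CommutativeSemigroup (CommutativeRing.*-commutativeSemigroup seriesRing)
  renaming (interchange to *-interchange) using ()
open import Algebra.Properties.Group (CommutativeRing.+-group seriesRing)
  using (x∙y⁻¹≈ε⇒x≈y; x≈y⇒x∙y⁻¹≈ε)

X*-suc : ∀ f n → (X * f) (suc n) ≡ f n
X*-suc f n = begin
  (X * f) (suc n)            ≡⟨ *-coeff X f (suc n) ⟩
  (X ⊗ f) (suc n)            ≡⟨ ⊗-suc X f n ⟩
  + 0 ℤ.+ (shift X ⊗ f) n    ≡⟨ ℤₚ.+-identityˡ _ ⟩
  (shift X ⊗ f) n            ≡⟨ coeff (⊗-cong shift-X (≈-refl {f})) n ⟩
  (const (+ 1) ⊗ f) n        ≡⟨ coeff (⊗-identityˡ f) n ⟩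
  f n                        ∎
  where
  open ≡-Reasoning
  shift-X : shift X ≈ const (+ 1)
  shift-X = coeffwise λ { zero → refl ; (suc n) → refl }

X*-zero : ∀ f → (X * f) zero ≡ + 0
X*-zero f = *-coeff X f zero

*-cancelˡ-X : ∀ {f g} → X * f ≈ X * g → f ≈ g
*-cancelˡ-X {f} {g} Xf≈Xg = coeffwise λ n →
  trans (sym (X*-suc f n)) (trans (coeff Xf≈Xg (suc n)) (X*-suc g n))

private
  *-cancelʳ-≢0 : ∀ a b → b ≢ + 0 → a ℤ.* b ≡ + 0 → a ≡ + 0
  *-cancelʳ-≢0 a b b≢0 ab≡0 with ℤₚ.i*j≡0⇒i≡0∨j≡0 a ab≡0
  ... | inj₁ a≡0 = a≡0
  ... | inj₂ b≡0 = ⊥-elim (b≢0 b≡0)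

h*u≈0⇒h≈0 : ∀ {u h} → u zero ≢ + 0 → h * u ≈ 0# → h ≈ 0#
h*u≈0⇒h≈0 {u} {h} u₀≢0 hu≈0 = coeffwise λ n → trans (vanish n n ℕₚ.≤-refl) (sym (const0≡0 n))
  where
  -- the n-th coefficient of h * u is h n * u 0 plus terms in earlier coefficients of h
  vanish : ∀ n i → i ℕ.≤ n → h i ≡ + 0
  vanish zero .zero ℕ.z≤n = *-cancelʳ-≢0 (h zero) (u zero) u₀≢0 (trans (sym (*-coeff h u zero)) (coeff hu≈0 zero))
  vanish (suc n) i i≤1+n with ℕₚ.m≤n⇒m<n∨m≡n i≤1+n
  ... | inj₁ (ℕ.s≤s i≤n) = vanish n i i≤n
  ... | inj₂ refl        = *-cancelʳ-≢0 (h (suc n)) (u zero) u₀≢0 (begin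
    h (suc n) ℤ.* u zero                 ≡⟨ cong (λ j → h (suc n) ℤ.* u j) (ℕₚ.n∸n≡0 n) ⟨
    h (suc n) ℤ.* u (n ∸ n)              ≡⟨ ℤₚ.+-identityˡ _ ⟨
    + 0 ℤ.+ h (suc n) ℤ.* u (n ∸ n)      ≡⟨ cong (ℤ._+ h (suc n) ℤ.* u (n ∸ n)) earlier ⟨
    (h ⊗ u) (suc n)                      ≡⟨ *-coeff h u (suc n) ⟨
    (h * u) (suc n)                      ≡⟨ coeff hu≈0 (suc n) ⟩
    + 0                                  ∎)
    where
    open ≡-Reasoning
    earlier : sumUpTo (λ j → h j ℤ.* u (suc n ∸ j)) n ≡ + 0
    earlier = trans (sumUpTo-cong n λ j j≤n → cong (ℤ._* u (suc n ∸ j)) (vanish n j j≤n))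
                    (sumUpTo-zero _ n λ _ → refl)

*-cancelˡ-const≢0 : ∀ {u f g} → u zero ≢ + 0 → u * f ≈ u * g → f ≈ g
*-cancelˡ-const≢0 {u} {f} {g} u₀≢0 uf≈ug = x∙y⁻¹≈ε⇒x≈y f g (h*u≈0⇒h≈0 u₀≢0 (begin
  (f - g) * u    ≈⟨ solve 3 (λ f g u → (f :- g) :* u := u :* f :- u :* g) ≈-refl f g u ⟩
  u * f - u * g  ≈⟨ x≈y⇒x∙y⁻¹≈ε uf≈ug ⟩
  0#             ∎))
  where open ≈-Reasoning

record NonZero (f : Series) : Set where
  constructor mkNonZero
  field
    order   : ℕ
    unit    : Series
    factors : f ≈ X ^ order * unit
    unit₀≢0 : unit zero ≢ + 0

X^-coeff : ∀ i u → (X ^ i * u) i ≡ u zero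
X^-coeff zero    u = trans (*-coeff 1# u zero) (ℤₚ.*-identityˡ (u zero))
X^-coeff (suc i) u = trans (coeff (*-assoc X (X ^ i) u) (suc i)) (trans (X*-suc (X ^ i * u) i) (X^-coeff i u))

NonZero⇒coeff≢0 : ∀ {f} → NonZero f → ∃ λ n → f n ≢ + 0
NonZero⇒coeff≢0 (mkNonZero i u f≈ u₀≢0) = i , λ fᵢ≡0 → u₀≢0 (trans (sym (X^-coeff i u)) (trans (sym (coeff f≈ i)) fᵢ≡0))

NonZero-resp-≈ : ∀ {f g} → f ≈ g → NonZero f → NonZero g
NonZero-resp-≈ f≈g (mkNonZero i u f≈ u₀≢0) = mkNonZero i u (≈-trans (≈-sym f≈g) f≈) u₀≢0

const≢0⇒NonZero : ∀ {f} → f zero ≢ + 0 → NonZero f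
const≢0⇒NonZero {f} f₀≢0 = mkNonZero 0 f (≈-sym (*-identityˡ f)) f₀≢0

NonZero-* : ∀ {f g} → NonZero f → NonZero g → NonZero (f * g)
NonZero-* (mkNonZero i u f≈ u₀≢0) (mkNonZero j w g≈ w₀≢0) = mkNonZero (i ℕ.+ j) (u * w) factors unit₀≢0
  where
  open ≈-Reasoning
  factors : _ * _ ≈ X ^ (i ℕ.+ j) * (u * w)
  factors = begin
    _ * _                        ≈⟨ *-cong f≈ g≈ ⟩
    (X ^ i * u) * (X ^ j * w)    ≈⟨ *-interchange (X ^ i) u (X ^ j) w ⟩
    (X ^ i * X ^ j) * (u * w)    ≈⟨ *-cong (≈-sym (^-homo-* X i j)) ≈-refl ⟩
    X ^ (i ℕ.+ j) * (u * w)      ∎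
  unit₀≢0 : (u * w) zero ≢ + 0
  unit₀≢0 = λ uw₀≡0 → [ u₀≢0 , w₀≢0 ]′ (ℤₚ.i*j≡0⇒i≡0∨j≡0 (u zero) (trans (sym (*-coeff u w zero)) uw₀≡0))

NonZero-[-X]^ : ∀ n → NonZero ((- X) ^ n)
NonZero-[-X]^ zero    = const≢0⇒NonZero λ ()
NonZero-[-X]^ (suc n) = NonZero-* (mkNonZero 1 (const ℤ.-1ℤ) (solve 1 (λ x → :- x := (x :* con (+ 1)) :* con ℤ.-1ℤ) ≈-refl X) λ ())
                                  (NonZero-[-X]^ n)

*-cancelˡ-X^ : ∀ i {f g} → X ^ i * f ≈ X ^ i * g → f ≈ g
*-cancelˡ-X^ zero    {f} {g} f≈g = ≈-trans (≈-sym (*-identityˡ f)) (≈-trans f≈g (*-identityˡ g))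
*-cancelˡ-X^ (suc i) {f} {g} Xf≈Xg =
  *-cancelˡ-X^ i (*-cancelˡ-X (≈-trans (≈-sym (*-assoc X (X ^ i) f)) (≈-trans Xf≈Xg (*-assoc X (X ^ i) g))))

*-cancelˡ-NonZero : ∀ {w f g} → NonZero w → w * f ≈ w * g → f ≈ g
*-cancelˡ-NonZero {w} {f} {g} (mkNonZero i u w≈ u₀≢0) wf≈wg =
  *-cancelˡ-const≢0 u₀≢0 (*-cancelˡ-X^ i (begin
    X ^ i * (u * f)   ≈⟨ *-assoc (X ^ i) u f ⟨
    X ^ i * u * f     ≈⟨ *-cong w≈ ≈-refl ⟨
    w * f             ≈⟨ wf≈wg ⟩
    w * g             ≈⟨ *-cong w≈ ≈-refl ⟩
    X ^ i * u * g     ≈⟨ *-assoc (X ^ i) u g ⟩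
    X ^ i * (u * g)   ∎))
  where open ≈-Reasoning

NonZero-+X* : ∀ f g → f zero ≢ + 0 → NonZero (f + X * g)
NonZero-+X* f g f₀≢0 = const≢0⇒NonZero λ c₀≡0 → f₀≢0 (begin
  f zero                        ≡⟨ ℤₚ.+-identityʳ (f zero) ⟨
  f zero ℤ.+ + 0                ≡⟨ cong (ℤ._+_ (f zero)) (*-coeff X g zero) ⟨
  f zero ℤ.+ (X * g) zero       ≡⟨ +-coeff f (X * g) zero ⟨
  (f + X * g) zero              ≡⟨ c₀≡0 ⟩
  + 0                           ∎)
  where open ≡-Reasoning

sumFrom : ℕ → ℕ → (ℕ → Series) → Series
sumFrom s zero    f = 0#
sumFrom s (suc m) f = f s + sumFrom (suc s) m f

infix 10 ∑ ∑₁
∑ ∑₁ : ℕ → (ℕ → Series) → Series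
∑  = sumFrom 0
∑₁ = sumFrom 1
syntax ∑ m (λ c → e) = ∑[ c < m ] e
syntax ∑₁ k (λ a → e) = ∑[ a ∈1… k ] e

≈-cong : ∀ (F : ℕ → Series) {a b} → a ≡ b → F a ≈ F b
≈-cong F refl = ≈-refl

sumFrom-cong : ∀ s m {f g} → (∀ a → s ℕ.≤ a → a ℕ.< s ℕ.+ m → f a ≈ g a) → sumFrom s m f ≈ sumFrom s m g
sumFrom-cong s zero    f≈g = ≈-refl
sumFrom-cong s (suc m) f≈g = +-cong (f≈g s ℕₚ.≤-refl (ℕₚ.m<m+n s ℕₚ.0<1+n))
  (sumFrom-cong (suc s) m λ a s<a a<1+s+m → f≈g a (ℕₚ.<⇒≤ s<a) (ℕₚ.≤-trans a<1+s+m (ℕₚ.≤-reflexive (sym (ℕₚ.+-suc s m)))))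

∑₁-cong : ∀ k {f g} → (∀ a → 1 ℕ.≤ a → a ℕ.≤ k → f a ≈ g a) → ∑₁ k f ≈ ∑₁ k g
∑₁-cong k f≈g = sumFrom-cong 1 k λ { a 1≤a (ℕ.s≤s a≤k) → f≈g a 1≤a a≤k }

sumFrom-suc : ∀ s m f → sumFrom (suc s) m f ≈ sumFrom s m (λ a → f (suc a))
sumFrom-suc s zero    f = ≈-refl
sumFrom-suc s (suc m) f = +-cong ≈-refl (sumFrom-suc (suc s) m f)

sumFrom-+ : ∀ s m f g → sumFrom s m (λ a → f a + g a) ≈ sumFrom s m f + sumFrom s m g
sumFrom-+ s zero    f g = solve 0 (con (+ 0) := con (+ 0) :+ con (+ 0)) ≈-refl
sumFrom-+ s (suc m) f g = ≈-trans (+-cong ≈-refl (sumFrom-+ (suc s) m f g))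
  (solve 4 (λ a b c d → (a :+ b) :+ (c :+ d) := (a :+ c) :+ (b :+ d)) ≈-refl (f s) (g s) _ _)

*-distribˡ-sumFrom : ∀ s m h f → h * sumFrom s m f ≈ sumFrom s m (λ a → h * f a)
*-distribˡ-sumFrom s zero    h f = zeroʳ h
*-distribˡ-sumFrom s (suc m) h f = ≈-trans (distribˡ h (f s) _) (+-cong ≈-refl (*-distribˡ-sumFrom (suc s) m h f))

*-distribʳ-sumFrom : ∀ s m h f → sumFrom s m f * h ≈ sumFrom s m (λ a → f a * h)
*-distribʳ-sumFrom s m h f = ≈-trans (*-comm _ h) (≈-trans (*-distribˡ-sumFrom s m h f) (sumFrom-cong s m λ a _ _ → *-comm h (f a)))

sumFrom-zero : ∀ s m {f} → (∀ a → f a ≈ 0#) → sumFrom s m f ≈ 0#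
sumFrom-zero s zero    f≈0 = ≈-refl
sumFrom-zero s (suc m) f≈0 = ≈-trans (+-cong (f≈0 s) (sumFrom-zero (suc s) m f≈0)) (+-identityˡ 0#)

sumFrom-neg : ∀ s m f → sumFrom s m (λ a → - f a) ≈ - sumFrom s m f
sumFrom-neg s zero    f = solve 0 (con (+ 0) := :- con (+ 0)) ≈-refl
sumFrom-neg s (suc m) f = ≈-trans (+-cong ≈-refl (sumFrom-neg (suc s) m f))
  (solve 2 (λ a b → :- a :+ :- b := :- (a :+ b)) ≈-refl (f s) (sumFrom (suc s) m f))

sumFrom-last : ∀ s m f → sumFrom s (suc m) f ≈ sumFrom s m f + f (s ℕ.+ m)
sumFrom-last s zero    f = ≈-trans (+-comm (f s) 0#) (+-cong ≈-refl (≈-cong f (sym (ℕₚ.+-identityʳ s))))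
sumFrom-last s (suc m) f = ≈-trans (+-cong ≈-refl (sumFrom-last (suc s) m f))
  (≈-trans (≈-sym (+-assoc (f s) _ _)) (+-cong ≈-refl (≈-cong f (sym (ℕₚ.+-suc s m)))))

sumFrom-const : ∀ s m h → sumFrom s m (λ _ → h) ≈ const (+ m) * h
sumFrom-const s zero    h = ≈-sym (zeroˡ h)
sumFrom-const s (suc m) h = ≈-trans (+-cong ≈-refl (sumFrom-const (suc s) m h))
  (≈-trans (solve 2 (λ h k → h :+ k :* h := (con (+ 1) :+ k) :* h) ≈-refl h (const (+ m)))
           (*-cong (≈-sym (const-+ 1 m)) ≈-refl))

∑₁-reflect : ∀ k f → ∑₁ k f ≈ ∑[ a ∈1… k ] f (suc k ∸ a)
∑₁-reflect zero    f = ≈-refl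
∑₁-reflect (suc k) f = begin
  ∑₁ (suc k) f                                       ≈⟨ sumFrom-last 1 k f ⟩
  ∑₁ k f + f (suc k)                                 ≈⟨ +-cong (∑₁-reflect k f) ≈-refl ⟩
  ∑[ a ∈1… k ] f (suc k ∸ a) + f (suc k)             ≈⟨ +-comm _ _ ⟩
  f (suc k) + ∑[ a ∈1… k ] f (suc (suc k) ∸ suc a)   ≈⟨ +-cong ≈-refl (sumFrom-suc 1 k (λ a → f (suc (suc k) ∸ a))) ⟨
  ∑[ a ∈1… suc k ] f (suc (suc k) ∸ a)               ∎
  where open ≈-Reasoning

indicator : Bool → ℕ
indicator true  = 1
indicator false = 0

opaque
  δ : ℕ → ℕ → Series
  δ a b = if a ℕ.≡ᵇ b then 1# else 0#

  δ-indicator : ∀ a b → δ a b ≈ const (+ indicator (a ℕ.≡ᵇ b))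
  δ-indicator a b with a ℕ.≡ᵇ b
  ... | true  = ≈-refl
  ... | false = ≈-refl

  δ-diag : ∀ a → δ a a ≈ 1#
  δ-diag zero    = ≈-refl
  δ-diag (suc a) = δ-diag a

  δ-≢ : ∀ {a b} → a ≢ b → δ a b ≈ 0#
  δ-≢ {a} {b} a≢b with a ℕ.≡ᵇ b in eq
  ... | true  = ⊥-elim (a≢b (ℕₚ.≡ᵇ⇒≡ a b (subst T (sym eq) _)))
  ... | false = ≈-refl

sumFrom-δ-outside : ∀ s m d (F : ℕ → Series) → (∀ a → s ℕ.≤ a → a ℕ.< s ℕ.+ m → a ≢ d) →
                    sumFrom s m (λ a → δ a d * F a) ≈ 0#
sumFrom-δ-outside s m d F outside = begin
  sumFrom s m (λ a → δ a d * F a)  ≈⟨ sumFrom-cong s m (λ a s≤a a<s+m → *-cong (δ-≢ (outside a s≤a a<s+m)) ≈-refl) ⟩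
  sumFrom s m (λ a → 0# * F a)     ≈⟨ sumFrom-zero s m (λ a → zeroˡ (F a)) ⟩
  0#                               ∎
  where open ≈-Reasoning

sumFrom-δ : ∀ s m d (F : ℕ → Series) → s ℕ.≤ d → d ℕ.< s ℕ.+ m → sumFrom s m (λ a → δ a d * F a) ≈ F d
sumFrom-δ s zero    d F s≤d d<s+0 = ⊥-elim (ℕₚ.<⇒≱ d<s+0 (ℕₚ.≤-trans (ℕₚ.≤-reflexive (ℕₚ.+-identityʳ s)) s≤d))
sumFrom-δ s (suc m) d F s≤d d<s+1+m with s ℕₚ.≟ d
... | yes refl = begin
  δ s s * F s + sumFrom (suc s) m (λ a → δ a s * F a)
    ≈⟨ +-cong (*-cong (δ-diag s) ≈-refl) (sumFrom-δ-outside (suc s) m s F λ a s<a _ a≡s → ℕₚ.<⇒≢ s<a (sym a≡s)) ⟩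
  1# * F s + 0#
    ≈⟨ solve 1 (λ a → con (+ 1) :* a :+ con (+ 0) := a) ≈-refl (F s) ⟩
  F s ∎
  where open ≈-Reasoning
... | no s≢d = begin
  δ s d * F s + sumFrom (suc s) m (λ a → δ a d * F a)
    ≈⟨ +-cong (*-cong (δ-≢ s≢d) ≈-refl)
              (sumFrom-δ (suc s) m d F (ℕₚ.≤∧≢⇒< s≤d s≢d) (ℕₚ.<-≤-trans d<s+1+m (ℕₚ.≤-reflexive (ℕₚ.+-suc s m)))) ⟩
  0# * F s + F d
    ≈⟨ solve 2 (λ a b → con (+ 0) :* a :+ b := b) ≈-refl (F s) (F d) ⟩
  F d ∎
  where open ≈-Reasoning

∑₁-δ : ∀ k d (F : ℕ → Series) → 1 ℕ.≤ d → d ℕ.≤ k → ∑[ a ∈1… k ] (δ a d * F a) ≈ F d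
∑₁-δ k d F 1≤d d≤k = sumFrom-δ 1 k d F 1≤d (ℕ.s≤s d≤k)

∑₁-*-δ+ : ∀ k d (F : ℕ → Series) c → 1 ℕ.≤ d → d ℕ.≤ k → ∑[ a ∈1… k ] (F a * (δ a d + c)) ≈ F d + c * ∑₁ k F
∑₁-*-δ+ k d F c 1≤d d≤k = begin
  ∑[ a ∈1… k ] (F a * (δ a d + c))
    ≈⟨ ∑₁-cong k (λ a _ _ → solve 3 (λ f e c → f :* (e :+ c) := e :* f :+ c :* f) ≈-refl (F a) (δ a d) c) ⟩
  ∑[ a ∈1… k ] (δ a d * F a + c * F a)          ≈⟨ sumFrom-+ 1 k _ _ ⟩
  ∑[ a ∈1… k ] (δ a d * F a) + ∑[ a ∈1… k ] (c * F a)  ≈⟨ +-cong (∑₁-δ k d F 1≤d d≤k) (≈-sym (*-distribˡ-sumFrom 1 k c F)) ⟩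
  F d + c * ∑₁ k F                              ∎
  where open ≈-Reasoning

∑₁-δ*-* : ∀ k d c (G : ℕ → Series) → 1 ℕ.≤ d → d ℕ.≤ k → ∑[ a ∈1… k ] (δ a d * c * G a) ≈ c * G d
∑₁-δ*-* k d c G 1≤d d≤k = ≈-trans (∑₁-cong k λ a _ _ → *-assoc (δ a d) c (G a)) (∑₁-δ k d (λ a → c * G a) 1≤d d≤k)

restrict : ℕ → (ℕ → Series) → ℕ → Series
restrict k f e = ∑[ c ∈1… k ] (δ c e * f c)

restrict-inside : ∀ k f e → 1 ℕ.≤ e → e ℕ.≤ k → restrict k f e ≈ f e
restrict-inside k f e = ∑₁-δ k e f

restrict-0 : ∀ k f → restrict k f 0 ≈ 0#
restrict-0 k f = sumFrom-δ-outside 1 k 0 f λ { a (ℕ.s≤s _) _ () }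

restrict-suc : ∀ k f → restrict k f (suc k) ≈ 0#
restrict-suc k f = sumFrom-δ-outside 1 k (suc k) f λ { a _ (ℕ.s≤s a≤k) refl → ℕₚ.<-irrefl refl a≤k }

tridiag : (ℕ → Series) → ℕ → Series
tridiag f a = (1# + X) * f a + X * (f (pred a) + f (suc a))

∑₁-shift : ∀ k (f g : ℕ → Series) → f 0 ≈ 0# → g (suc k) ≈ 0# →
           ∑[ a ∈1… k ] (f a * g (suc a)) ≈ ∑[ a ∈1… k ] (f (pred a) * g a)
∑₁-shift k f g f₀≈0 gₖ₊₁≈0 = begin
  sumFrom 1 k h              ≈⟨ +-identityˡ _ ⟨
  0# + sumFrom 1 k h         ≈⟨ +-cong (≈-trans (*-cong f₀≈0 ≈-refl) (zeroˡ _)) ≈-refl ⟨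
  sumFrom 0 (suc k) h        ≈⟨ sumFrom-last 0 k h ⟩
  sumFrom 0 k h + h k        ≈⟨ +-cong ≈-refl (≈-trans (*-cong ≈-refl gₖ₊₁≈0) (zeroʳ _)) ⟩
  sumFrom 0 k h + 0#         ≈⟨ +-identityʳ _ ⟩
  sumFrom 0 k h              ≈⟨ sumFrom-suc 0 k (λ a → f (pred a) * g a) ⟨
  ∑[ a ∈1… k ] (f (pred a) * g a) ∎
  where
  open ≈-Reasoning
  h : ℕ → Series
  h a = f a * g (suc a)

∑₁-*-tridiag : ∀ k (f g : ℕ → Series) → ∑[ a ∈1… k ] (f a * tridiag g a) ≈
  (1# + X) * ∑[ a ∈1… k ] (f a * g a) + X * (∑[ a ∈1… k ] (f a * g (pred a)) + ∑[ a ∈1… k ] (f a * g (suc a)))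
∑₁-*-tridiag k f g = begin
  ∑[ a ∈1… k ] (f a * tridiag g a)
    ≈⟨ ∑₁-cong k (λ a _ _ → solve 5 (λ x f g g₋ g₊ → f :* ((con (+ 1) :+ x) :* g :+ x :* (g₋ :+ g₊))
                                     := (con (+ 1) :+ x) :* (f :* g) :+ x :* (f :* g₋ :+ f :* g₊)) ≈-refl X (f a) (g a) (g (pred a)) (g (suc a))) ⟩
  ∑[ a ∈1… k ] ((1# + X) * (f a * g a) + X * (f a * g (pred a) + f a * g (suc a)))
    ≈⟨ sumFrom-+ 1 k _ _ ⟩
  ∑[ a ∈1… k ] ((1# + X) * (f a * g a)) + ∑[ a ∈1… k ] (X * (f a * g (pred a) + f a * g (suc a)))
    ≈⟨ +-cong (*-distribˡ-sumFrom 1 k _ _) (*-distribˡ-sumFrom 1 k _ _) ⟨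
  (1# + X) * ∑[ a ∈1… k ] (f a * g a) + X * ∑[ a ∈1… k ] (f a * g (pred a) + f a * g (suc a))
    ≈⟨ +-cong ≈-refl (*-cong ≈-refl (sumFrom-+ 1 k _ _)) ⟩
  (1# + X) * ∑[ a ∈1… k ] (f a * g a) + X * (∑[ a ∈1… k ] (f a * g (pred a)) + ∑[ a ∈1… k ] (f a * g (suc a))) ∎
  where open ≈-Reasoning

∑₁-tridiag-symmetric : ∀ k (f g : ℕ → Series) → f 0 ≈ 0# → g 0 ≈ 0# → f (suc k) ≈ 0# → g (suc k) ≈ 0# →
                       ∑[ a ∈1… k ] (f a * tridiag g a) ≈ ∑[ a ∈1… k ] (tridiag f a * g a)
∑₁-tridiag-symmetric k f g f₀ g₀ fₖ₊₁ gₖ₊₁ = begin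
  ∑[ a ∈1… k ] (f a * tridiag g a)
    ≈⟨ ∑₁-*-tridiag k f g ⟩
  (1# + X) * ∑[ a ∈1… k ] (f a * g a) + X * (∑[ a ∈1… k ] (f a * g (pred a)) + ∑[ a ∈1… k ] (f a * g (suc a)))
    ≈⟨ +-cong (*-cong ≈-refl (swap f g))
              (*-cong ≈-refl (≈-trans (+-comm _ _) (+-cong (shift-swap f g f₀ gₖ₊₁) (≈-sym (shift-swap g f g₀ fₖ₊₁))))) ⟩
  (1# + X) * ∑[ a ∈1… k ] (g a * f a) + X * (∑[ a ∈1… k ] (g a * f (pred a)) + ∑[ a ∈1… k ] (g a * f (suc a)))
    ≈⟨ ∑₁-*-tridiag k g f ⟨
  ∑[ a ∈1… k ] (g a * tridiag f a)
    ≈⟨ swap g (tridiag f) ⟩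
  ∑[ a ∈1… k ] (tridiag f a * g a) ∎
  where
  open ≈-Reasoning
  swap : ∀ (u w : ℕ → Series) → ∑[ a ∈1… k ] (u a * w a) ≈ ∑[ a ∈1… k ] (w a * u a)
  swap u w = ∑₁-cong k λ a _ _ → *-comm (u a) (w a)
  shift-swap : ∀ (u w : ℕ → Series) → u 0 ≈ 0# → w (suc k) ≈ 0# → ∑[ a ∈1… k ] (u a * w (suc a)) ≈ ∑[ a ∈1… k ] (w a * u (pred a))
  shift-swap u w u₀ wₖ₊₁ = ≈-trans (∑₁-shift k u w u₀ wₖ₊₁) (swap (λ a → u (pred a)) w)

∑₁-tridiag-pairing : ∀ k (f g F G : ℕ → Series) → f 0 ≈ 0# → g 0 ≈ 0# → f (suc k) ≈ 0# → g (suc k) ≈ 0# →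
                     (∀ a → 1 ℕ.≤ a → a ℕ.≤ k → tridiag f a ≈ F a) → (∀ a → 1 ℕ.≤ a → a ℕ.≤ k → tridiag g a ≈ G a) →
                     ∑[ a ∈1… k ] (f a * G a) ≈ ∑[ a ∈1… k ] (F a * g a)
∑₁-tridiag-pairing k f g F G f₀ g₀ fₖ₊₁ gₖ₊₁ Mf≈F Mg≈G = begin
  ∑[ a ∈1… k ] (f a * G a)            ≈⟨ ∑₁-cong k (λ a 1≤a a≤k → *-cong ≈-refl (Mg≈G a 1≤a a≤k)) ⟨
  ∑[ a ∈1… k ] (f a * tridiag g a)    ≈⟨ ∑₁-tridiag-symmetric k f g f₀ g₀ fₖ₊₁ gₖ₊₁ ⟩
  ∑[ a ∈1… k ] (tridiag f a * g a)    ≈⟨ ∑₁-cong k (λ a 1≤a a≤k → *-cong (Mf≈F a 1≤a a≤k) ≈-refl) ⟩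
  ∑[ a ∈1… k ] (F a * g a)            ∎
  where open ≈-Reasoning

-- v (n + 1) = (-x)ⁿ Uₙ(ψ), so that Uₙ(ψ) is the fraction v (n + 1) / (-x)ⁿ.
v : ℕ → Series
v zero                = 0#
v (suc zero)          = 1#
v (suc (suc n))       = (1# + X) * v (suc n) - X * X * v n

-- Names starting with ':' are terms in the syntax of the ring solver.
:next : ∀ {n} → SeriesSolver.Polynomial n → SeriesSolver.Polynomial n → SeriesSolver.Polynomial n → SeriesSolver.Polynomial n
:next x a b = (con (+ 1) :+ x) :* b :- (x :* x) :* a

v-const-term : ∀ n → v (suc n) zero ≡ + 1
v-const-term zero    = refl
v-const-term (suc n)
  rewrite +-coeff ((1# + X) * v (suc n)) (- (X * X * v n)) zero | *-coeff (1# + X) (v (suc n)) zero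
        | +-coeff 1# X zero | neg-coeff (X * X * v n) zero | *-coeff (X * X) (v n) zero | *-coeff X X zero | v-const-term n = refl

NonZero-v : ∀ n → NonZero (v (suc n))
NonZero-v n = const≢0⇒NonZero λ v₀≡0 → case trans (sym (v-const-term n)) v₀≡0 of λ ()

v-add : ∀ n m → v (suc (n ℕ.+ m)) ≈ v (suc n) * v (suc m) - X * X * v n * v m
v-add zero m = solve 3 (λ x a b → b := con (+ 1) :* b :- (x :* x) :* con (+ 0) :* a) ≈-refl X (v m) (v (suc m))
v-add (suc zero) m = solve 3 (λ x a b → :next x a b := :next x (con (+ 0)) (con (+ 1)) :* b :- (x :* x) :* con (+ 1) :* a)
                            ≈-refl X (v m) (v (suc m))
v-add (suc (suc n)) m = begin
  (1# + X) * v (suc (suc n ℕ.+ m)) - X * X * v (suc (n ℕ.+ m))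
    ≈⟨ +-cong (*-cong ≈-refl (v-add (suc n) m)) (-‿cong (*-cong ≈-refl (v-add n m))) ⟩
  (1# + X) * (v (suc (suc n)) * v (suc m) - X * X * v (suc n) * v m) - X * X * (v (suc n) * v (suc m) - X * X * v n * v m)
    ≈⟨ solve 5 (λ x a b c d → (con (+ 1) :+ x) :* (:next x c d :* b :- (x :* x) :* d :* a) :- (x :* x) :* (d :* b :- (x :* x) :* c :* a)
                            := :next x d (:next x c d) :* b :- (x :* x) :* :next x c d :* a) ≈-refl X (v m) (v (suc m)) (v n) (v (suc n)) ⟩
  v (suc (suc (suc n))) * v (suc m) - X * X * v (suc (suc n)) * v m ∎
  where open ≈-Reasoning

v-cassini : ∀ n → v (suc n) * v (suc n) - v n * v (suc (suc n)) ≈ (- X) ^ n * (- X) ^ n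
v-cassini zero    = solve 1 (λ x → con (+ 1) :* con (+ 1) :- con (+ 0) :* :next x (con (+ 0)) (con (+ 1)) := con (+ 1) :* con (+ 1)) ≈-refl X
v-cassini (suc n) = begin
  v (suc (suc n)) * v (suc (suc n)) - v (suc n) * v (suc (suc (suc n)))
    ≈⟨ solve 3 (λ x a b → :next x a b :* :next x a b :- b :* :next x b (:next x a b)
                        := (:- x) :* (:- x) :* (b :* b :- a :* :next x a b)) ≈-refl X (v n) (v (suc n)) ⟩
  (- X) * (- X) * (v (suc n) * v (suc n) - v n * v (suc (suc n)))
    ≈⟨ *-cong ≈-refl (v-cassini n) ⟩
  (- X) * (- X) * ((- X) ^ n * (- X) ^ n)
    ≈⟨ solve 3 (λ x p q → (:- x) :* (:- x) :* (p :* q) := ((:- x) :* p) :* ((:- x) :* q)) ≈-refl X ((- X) ^ n) ((- X) ^ n) ⟩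
  (- X) ^ suc n * (- X) ^ suc n ∎
  where open ≈-Reasoning

1+3X discr : Series
1+3X  = 1# + const (+ 3) * X
-- the discriminant (1 + x)² - 4x² of the recurrence of v
discr = (1# - X) * 1+3X

-- the companion (Lucas) sequence of v, shifted by one
lucas : ℕ → Series
lucas m = (1# + X) * v (suc m) - const (+ 2) * (X * X) * v m

:1+3X :discr : ∀ {n} → SeriesSolver.Polynomial n → SeriesSolver.Polynomial n
:1+3X x  = con (+ 1) :+ con (+ 3) :* x
:discr x = (con (+ 1) :- x) :* :1+3X x

:lucas : ∀ {n} → SeriesSolver.Polynomial n → SeriesSolver.Polynomial n → SeriesSolver.Polynomial n → SeriesSolver.Polynomial n
:lucas x a b = (con (+ 1) :+ x) :* b :- con (+ 2) :* (x :* x) :* a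

weightedSum : Series → (ℕ → Series) → ℕ → Series
weightedSum r t m = ∑[ a ∈1… m ] (r ^ (suc m ∸ a) * t a)

weightedSum-suc : ∀ r t m → weightedSum r t (suc m) ≈ r * (weightedSum r t m + t (suc m))
weightedSum-suc r t m = begin
  weightedSum r t (suc m)
    ≈⟨ sumFrom-last 1 m _ ⟩
  ∑[ a ∈1… m ] (r ^ (suc (suc m) ∸ a) * t a) + r ^ (suc m ∸ m) * t (suc m)
    ≈⟨ +-cong (∑₁-cong m λ a _ a≤m → *-cong (^-congʳ r (ℕₚ.+-∸-assoc 1 (ℕₚ.m≤n⇒m≤1+n a≤m))) ≈-refl)
              (*-cong (^-congʳ r (ℕₚ.m+n∸n≡m 1 m)) ≈-refl) ⟩
  ∑[ a ∈1… m ] (r * r ^ (suc m ∸ a) * t a) + r * 1# * t (suc m)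
    ≈⟨ +-cong (∑₁-cong m λ a _ _ → *-assoc r _ _) (*-cong (*-identityʳ r) ≈-refl) ⟩
  ∑[ a ∈1… m ] (r * (r ^ (suc m ∸ a) * t a)) + r * t (suc m)
    ≈⟨ +-cong (*-distribˡ-sumFrom 1 m r _) ≈-refl ⟨
  r * weightedSum r t m + r * t (suc m)
    ≈⟨ distribˡ r _ _ ⟨
  r * (weightedSum r t m + t (suc m)) ∎
  where open ≈-Reasoning

1+3X*weightedSum-v : ∀ m → 1+3X * weightedSum (- X) v m ≈ - (X * v (suc m) + X * X * v m + (- X) ^ suc m)
1+3X*weightedSum-v zero    = solve 1 (λ x → :1+3X x :* con (+ 0) := :- (x :* con (+ 1) :+ (x :* x) :* con (+ 0) :+ (:- x) :* con (+ 1))) ≈-refl X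
1+3X*weightedSum-v (suc m) = begin
  1+3X * weightedSum (- X) v (suc m)
    ≈⟨ *-cong ≈-refl (weightedSum-suc (- X) v m) ⟩
  1+3X * (- X * (weightedSum (- X) v m + v (suc m)))
    ≈⟨ solve 4 (λ x a b w → a :* ((:- x) :* (b :+ w)) := (:- x) :* (a :* b :+ a :* w)) ≈-refl X 1+3X _ _ ⟩
  - X * (1+3X * weightedSum (- X) v m + 1+3X * v (suc m))
    ≈⟨ *-cong ≈-refl (+-cong (1+3X*weightedSum-v m) ≈-refl) ⟩
  - X * (- (X * v (suc m) + X * X * v m + (- X) ^ suc m) + 1+3X * v (suc m))
    ≈⟨ solve 4 (λ x a b p → (:- x) :* (:- (x :* b :+ (x :* x) :* a :+ p) :+ :1+3X x :* b)
                          := :- (x :* :next x a b :+ (x :* x) :* b :+ (:- x) :* p)) ≈-refl X (v m) (v (suc m)) ((- X) ^ suc m) ⟩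
  - (X * v (suc (suc m)) + X * X * v (suc m) + (- X) ^ suc (suc m)) ∎
  where open ≈-Reasoning

discr*weightedSum-v² : ∀ m → discr * weightedSum (X * X) (λ a → v a * v a) m
                         ≈ X * X * v m * lucas m - const (+ 2) * const (+ m) * ((- X) ^ suc m * (- X) ^ suc m)
discr*weightedSum-v² zero = solve 1 (λ x → :discr x :* con (+ 0)
  := (x :* x) :* con (+ 0) :* :lucas x (con (+ 0)) (con (+ 1)) :- con (+ 2) :* con (+ 0) :* (((:- x) :* con (+ 1)) :* ((:- x) :* con (+ 1)))) ≈-refl X
discr*weightedSum-v² (suc m) = begin
  discr * weightedSum (X * X) v² (suc m)
    ≈⟨ *-cong ≈-refl (weightedSum-suc (X * X) v² m) ⟩
  discr * (X * X * (weightedSum (X * X) v² m + v² (suc m)))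
    ≈⟨ solve 4 (λ d x b w → d :* ((x :* x) :* (b :+ w)) := (x :* x) :* (d :* b :+ d :* w)) ≈-refl discr X _ _ ⟩
  X * X * (discr * weightedSum (X * X) v² m + discr * v² (suc m))
    ≈⟨ *-cong ≈-refl (+-cong (discr*weightedSum-v² m) ≈-refl) ⟩
  X * X * (X * X * v m * lucas m - const (+ 2) * const (+ m) * (p * p) + discr * v² (suc m))
    ≈⟨ solve 5 (λ x k a b p → (x :* x) :* ((x :* x) :* a :* :lucas x a b :- con (+ 2) :* k :* (p :* p) :+ :discr x :* (b :* b))
            := (x :* x) :* b :* :lucas x b (:next x a b) :- con (+ 2) :* (con (+ 1) :+ k) :* (((:- x) :* p) :* ((:- x) :* p))
               :+ con (+ 2) :* (x :* x) :* (p :* p :- (:next x a b :* :next x a b :- b :* :next x b (:next x a b))))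
            ≈-refl X (const (+ m)) (v m) (v (suc m)) p ⟩
  X * X * v (suc m) * lucas (suc m) - const (+ 2) * (1# + const (+ m)) * ((- X) ^ suc (suc m) * (- X) ^ suc (suc m))
    + const (+ 2) * (X * X) * (p * p - (v (suc (suc m)) * v (suc (suc m)) - v (suc m) * v (suc (suc (suc m)))))
    ≈⟨ +-cong (+-cong ≈-refl (-‿cong (*-cong (*-cong ≈-refl (≈-sym (const-+ 1 m))) ≈-refl)))
              (*-cong ≈-refl (x≈y⇒x∙y⁻¹≈ε (≈-sym (v-cassini (suc m))))) ⟩
  X * X * v (suc m) * lucas (suc m) - const (+ 2) * const (+ suc m) * ((- X) ^ suc (suc m) * (- X) ^ suc (suc m))
    + const (+ 2) * (X * X) * 0#
    ≈⟨ solve 2 (λ a x → a :+ con (+ 2) :* (x :* x) :* con (+ 0) := a) ≈-refl _ X ⟩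
  X * X * v (suc m) * lucas (suc m) - const (+ 2) * const (+ suc m) * ((- X) ^ suc (suc m) * (- X) ^ suc (suc m)) ∎
  where
  open ≈-Reasoning
  v² : ℕ → Series
  v² a = v a * v a
  p : Series
  p = (- X) ^ suc m

v-convolution : ℕ → Series
v-convolution m = ∑[ a ∈1… m ] (v a * v (suc m ∸ a))

v-convolution-suc-suc : ∀ m → v-convolution (suc (suc m)) ≈ (1# + X) * v-convolution (suc m) - X * X * v-convolution m + v (suc (suc m))
v-convolution-suc-suc m = begin
  v-convolution (suc (suc m))
    ≈⟨ sumFrom-last 1 (suc m) _ ⟩
  ∑[ a ∈1… suc m ] (v a * v (suc (suc (suc m)) ∸ a)) + v (suc (suc m)) * v (suc (suc (suc m)) ∸ suc (suc m))
    ≈⟨ +-cong (∑₁-cong (suc m) λ a _ a≤1+m → ≈-trans (≈-cong (λ j → v a * v j) (index-shift a≤1+m))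
                                               (*-distrib-next (v a) (suc m ∸ a)))
              (*-cong ≈-refl (≈-cong v (ℕₚ.m+n∸n≡m 1 (suc m)))) ⟩
  ∑[ a ∈1… suc m ] ((1# + X) * (v a * v (suc (suc m ∸ a))) - X * X * (v a * v (suc m ∸ a))) + v (suc (suc m)) * 1#
    ≈⟨ +-cong (linear (suc m) _ _) ≈-refl ⟩
  (1# + X) * ∑[ a ∈1… suc m ] (v a * v (suc (suc m ∸ a))) - X * X * ∑[ a ∈1… suc m ] (v a * v (suc m ∸ a)) + v (suc (suc m)) * 1#
    ≈⟨ +-cong (+-cong (*-cong ≈-refl (∑₁-cong (suc m) λ a _ a≤1+m → ≈-cong (λ j → v a * v j) (sym (ℕₚ.+-∸-assoc 1 a≤1+m))))
                      (-‿cong (*-cong ≈-refl (sumFrom-last 1 m _)))) ≈-refl ⟩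
  (1# + X) * v-convolution (suc m) - X * X * (v-convolution m + v (suc m) * v (suc m ∸ suc m)) + v (suc (suc m)) * 1#
    ≈⟨ +-cong (+-cong ≈-refl (-‿cong (*-cong ≈-refl (+-cong ≈-refl (*-cong ≈-refl (≈-cong v (ℕₚ.n∸n≡0 (suc m)))))))) ≈-refl ⟩
  (1# + X) * v-convolution (suc m) - X * X * (v-convolution m + v (suc m) * 0#) + v (suc (suc m)) * 1#
    ≈⟨ solve 5 (λ x s₁ s₀ w z → (con (+ 1) :+ x) :* s₁ :- (x :* x) :* (s₀ :+ w :* con (+ 0)) :+ z :* con (+ 1)
                             := (con (+ 1) :+ x) :* s₁ :- (x :* x) :* s₀ :+ z) ≈-refl X _ _ (v (suc m)) (v (suc (suc m))) ⟩
  (1# + X) * v-convolution (suc m) - X * X * v-convolution m + v (suc (suc m)) ∎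
  where
  open ≈-Reasoning
  index-shift : ∀ {a} → a ℕ.≤ suc m → suc (suc (suc m)) ∸ a ≡ suc (suc (suc m ∸ a))
  index-shift a≤1+m = trans (ℕₚ.+-∸-assoc 1 (ℕₚ.m≤n⇒m≤1+n a≤1+m)) (cong suc (ℕₚ.+-∸-assoc 1 a≤1+m))
  *-distrib-next : ∀ w j → w * v (suc (suc j)) ≈ (1# + X) * (w * v (suc j)) - X * X * (w * v j)
  *-distrib-next w j = solve 4 (λ x w a b → w :* :next x a b := (con (+ 1) :+ x) :* (w :* b) :- (x :* x) :* (w :* a)) ≈-refl X w (v j) (v (suc j))
  linear : ∀ n (f g : ℕ → Series) → ∑[ a ∈1… n ] ((1# + X) * f a - X * X * g a) ≈ (1# + X) * ∑₁ n f - X * X * ∑₁ n g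
  linear n f g = ≈-trans (sumFrom-+ 1 n _ _) (+-cong (≈-sym (*-distribˡ-sumFrom 1 n _ f))
                   (≈-trans (sumFrom-neg 1 n _) (-‿cong (≈-sym (*-distribˡ-sumFrom 1 n _ g)))))

discr*v-convolution : ∀ m → discr * v-convolution m ≈ const (+ m) * lucas m - const (+ 2) * (X * X) * v m
discr*v-convolution zero = solve 1 (λ x → :discr x :* con (+ 0) := con (+ 0) :* :lucas x (con (+ 0)) (con (+ 1)) :- con (+ 2) :* (x :* x) :* con (+ 0)) ≈-refl X
discr*v-convolution (suc zero) = solve 1 (λ x → :discr x :* (con (+ 1) :* con (+ 1) :+ con (+ 0))
  := con (+ 1) :* :lucas x (con (+ 1)) (:next x (con (+ 0)) (con (+ 1))) :- con (+ 2) :* (x :* x) :* con (+ 1)) ≈-refl X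
discr*v-convolution (suc (suc m)) = begin
  discr * v-convolution (suc (suc m))
    ≈⟨ *-cong ≈-refl (v-convolution-suc-suc m) ⟩
  discr * ((1# + X) * v-convolution (suc m) - X * X * v-convolution m + v (suc (suc m)))
    ≈⟨ solve 5 (λ d x s₁ s₀ w → d :* ((con (+ 1) :+ x) :* s₁ :- (x :* x) :* s₀ :+ w)
                             := (con (+ 1) :+ x) :* (d :* s₁) :- (x :* x) :* (d :* s₀) :+ d :* w) ≈-refl discr X _ _ _ ⟩
  (1# + X) * (discr * v-convolution (suc m)) - X * X * (discr * v-convolution m) + discr * v (suc (suc m))
    ≈⟨ +-cong (+-cong (*-cong ≈-refl (discr*v-convolution (suc m))) (-‿cong (*-cong ≈-refl (discr*v-convolution m)))) ≈-refl ⟩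
  (1# + X) * (const (+ suc m) * lucas (suc m) - const (+ 2) * (X * X) * v (suc m))
    - X * X * (const (+ m) * lucas m - const (+ 2) * (X * X) * v m) + discr * v (suc (suc m))
    ≈⟨ +-cong (+-cong (*-cong ≈-refl (+-cong (*-cong (const-+ 1 m) ≈-refl) ≈-refl)) ≈-refl) ≈-refl ⟩
  (1# + X) * ((1# + const (+ m)) * lucas (suc m) - const (+ 2) * (X * X) * v (suc m))
    - X * X * (const (+ m) * lucas m - const (+ 2) * (X * X) * v m) + discr * v (suc (suc m))
    ≈⟨ solve 4 (λ x k a b → (con (+ 1) :+ x) :* ((con (+ 1) :+ k) :* :lucas x b (:next x a b) :- con (+ 2) :* (x :* x) :* b)
                            :- (x :* x) :* (k :* :lucas x a b :- con (+ 2) :* (x :* x) :* a) :+ :discr x :* :next x a b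
                         := (con (+ 1) :+ (con (+ 1) :+ k)) :* :lucas x (:next x a b) (:next x b (:next x a b)) :- con (+ 2) :* (x :* x) :* :next x a b)
             ≈-refl X (const (+ m)) (v m) (v (suc m)) ⟩
  (1# + (1# + const (+ m))) * lucas (suc (suc m)) - const (+ 2) * (X * X) * v (suc (suc m))
    ≈⟨ +-cong (*-cong (≈-trans (+-cong ≈-refl (≈-sym (const-+ 1 m))) (≈-sym (const-+ 1 (suc m)))) ≈-refl) ≈-refl ⟩
  const (+ suc (suc m)) * lucas (suc (suc m)) - const (+ 2) * (X * X) * v (suc (suc m)) ∎
  where open ≈-Reasoning

count : ∀ {A : Set} → (A → Bool) → List A → ℕ
count p []       = 0
count p (x ∷ xs) = indicator (p x) ℕ.+ count p xs

length-filter : ∀ {A : Set} {P : A → Set} (P? : ∀ x → Dec (P x)) xs → length (filter P? xs) ≡ count (λ x → does (P? x)) xs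
length-filter P? [] = refl
length-filter P? (x ∷ xs) with does (P? x)
... | true  = cong suc (length-filter P? xs)
... | false = length-filter P? xs

count-++ : ∀ {A : Set} (p : A → Bool) xs ys → count p (xs ++ ys) ≡ count p xs ℕ.+ count p ys
count-++ p []       ys = refl
count-++ p (x ∷ xs) ys = trans (cong (indicator (p x) ℕ.+_) (count-++ p xs ys)) (sym (ℕₚ.+-assoc (indicator (p x)) _ _))

count-concatMap : ∀ {A B : Set} (p : B → Bool) (f : A → List B) xs → count p (concatMap f xs) ≡ sum (map (λ x → count p (f x)) xs)
count-concatMap p f []       = refl
count-concatMap p f (x ∷ xs) = trans (count-++ p (f x) (concat (map f xs))) (cong (count p (f x) ℕ.+_) (count-concatMap p f xs))

count-map : ∀ {A B : Set} (p : B → Bool) (f : A → B) xs → count p (map f xs) ≡ count (λ x → p (f x)) xs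
count-map p f []       = refl
count-map p f (x ∷ xs) = cong (indicator (p (f x)) ℕ.+_) (count-map p f xs)

count-∧ : ∀ {A : Set} (p q : A → Bool) b xs → (∀ x → p x ≡ b ∧ q x) → count p xs ≡ indicator b ℕ.* count q xs
count-∧ p q b []       p≡b∧q = sym (ℕₚ.*-zeroʳ (indicator b))
count-∧ p q b (x ∷ xs) p≡b∧q rewrite p≡b∧q x | count-∧ p q b xs p≡b∧q with b
... | true  = sym (ℕₚ.+-assoc (indicator (q x)) (count q xs) 0)
... | false = refl

∑ℕ : ℕ → (ℕ → ℕ) → ℕ
∑ℕ zero    f = 0
∑ℕ (suc m) f = f 0 ℕ.+ ∑ℕ m (λ c → f (suc c))

sum-map-tabulate : ∀ {A : Set} n (t : Fin n → A) (G : A → ℕ) (F : ℕ → ℕ) → (∀ i → G (t i) ≡ F (toℕ i)) →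
                   sum (map G (tabulate t)) ≡ ∑ℕ n F
sum-map-tabulate zero    t G F G≡F = refl
sum-map-tabulate (suc n) t G F G≡F =
  cong₂ ℕ._+_ (G≡F fzero) (sum-map-tabulate n (λ i → t (fsuc i)) G (λ c → F (suc c)) (λ i → G≡F (fsuc i)))

module _ (k : ℕ) where

  -- letters of [k] are 1, …, k here, i.e. suc (toℕ a) for a : Fin k
  far : ℕ → ℕ → ℕ
  far a c = indicator (not (ℕ.∣ a - c ∣ ℕ.≤ᵇ 1))

  walks : ℕ → ℕ → ℕ → ℕ
  walks zero    a b = far a b
  walks (suc m) a b = ∑ℕ k (λ c → far a (suc c) ℕ.* walks m (suc c) b)

  private
    chain? : ∀ {m} (a : Fin k) (w : Vec (Fin k) m) (b : Fin k) → Dec (All Good (zip (a Vec.∷ w) (w ∷ʳ b)))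
    chain? a w b = all? good? (zip (a Vec.∷ w) (w ∷ʳ b))

    count-chains : ∀ m a b → count (λ w → does (chain? a w b)) (words k m) ≡ walks m (suc (toℕ a)) (suc (toℕ b))
    count-chains zero    a b = trans (ℕₚ.+-identityʳ _) (cong indicator (Boolₚ.∧-identityʳ _))
    count-chains (suc m) a b = begin
      count (λ w → does (chain? a w b)) (concatMap (λ d → map (d Vec.∷_) (words k m)) (List.allFin k))
        ≡⟨ count-concatMap _ (λ d → map (d Vec.∷_) (words k m)) (List.allFin k) ⟩
      sum (map (λ d → count (λ w → does (chain? a w b)) (map (d Vec.∷_) (words k m))) (List.allFin k))
        ≡⟨ sum-map-tabulate k (λ d → d) _ _ (λ d → trans (count-map _ (d Vec.∷_) (words k m))
              (trans (count-∧ _ (λ w → does (chain? d w b)) _ (words k m) (λ w → refl))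
                     (cong (far (suc (toℕ a)) (suc (toℕ d)) ℕ.*_) (count-chains m d b)))) ⟩
      walks (suc m) (suc (toℕ a)) (suc (toℕ b)) ∎
      where open ≡-Reasoning

  -- a nonempty cyclic word a w is cyclic Hertzsprung iff a w a is a chain
  c-suc : ∀ m → c k (suc m) ≡ ∑ℕ k (λ a → walks m (suc a) (suc a))
  c-suc m = begin
    c k (suc m)
      ≡⟨ length-filter cyclicHertzsprung? (words k (suc m)) ⟩
    count (λ w → does (cyclicHertzsprung? w)) (concatMap (λ a → map (a Vec.∷_) (words k m)) (List.allFin k))
      ≡⟨ count-concatMap _ (λ a → map (a Vec.∷_) (words k m)) (List.allFin k) ⟩
    sum (map (λ a → count (λ w → does (cyclicHertzsprung? w)) (map (a Vec.∷_) (words k m))) (List.allFin k))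
      ≡⟨ sum-map-tabulate k (λ a → a) _ _ (λ a → trans (count-map _ (a Vec.∷_) (words k m)) (count-chains m a a)) ⟩
    ∑ℕ k (λ a → walks m (suc a) (suc a)) ∎
    where open ≡-Reasoning

const*-coeff : ∀ a f n → (const a * f) n ≡ a ℤ.* f n
const*-coeff a f zero    = *-coeff (const a) f zero
const*-coeff a f (suc n) = begin
  (const a * f) (suc n)                            ≡⟨ *-coeff (const a) f (suc n) ⟩
  (const a ⊗ f) (suc n)                            ≡⟨ ⊗-suc (const a) f n ⟩
  a ℤ.* f (suc n) ℤ.+ (shift (const a) ⊗ f) n       ≡⟨ cong (ℤ._+_ (a ℤ.* f (suc n))) (sumUpTo-zero _ n λ _ → refl) ⟩
  a ℤ.* f (suc n) ℤ.+ + 0                          ≡⟨ ℤₚ.+-identityʳ _ ⟩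
  a ℤ.* f (suc n)                                  ∎
  where open ≡-Reasoning

∑-coeff : ∀ m F (g : ℕ → ℕ) n → (∀ c → F c n ≡ + g c) → (∑ m F) n ≡ + ∑ℕ m g
∑-coeff zero    F g n _   = const0≡0 n
∑-coeff (suc m) F g n F≡g = begin
  (F 0 + sumFrom 1 m F) n                     ≡⟨ +-coeff (F 0) _ n ⟩
  F 0 n ℤ.+ sumFrom 1 m F n                   ≡⟨ cong₂ ℤ._+_ (F≡g 0) (coeff (sumFrom-suc 0 m F) n) ⟩
  + g 0 ℤ.+ (∑[ c < m ] F (suc c)) n          ≡⟨ cong (ℤ._+_ (+ g 0)) (∑-coeff m (λ c → F (suc c)) (λ c → g (suc c)) n (λ c → F≡g (suc c))) ⟩
  + (g 0 ℕ.+ ∑ℕ m (λ c → g (suc c)))          ∎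
  where open ≡-Reasoning

∑₁-coeff : ∀ k F (g : ℕ → ℕ) n → (∀ a → F a n ≡ + g a) → (∑₁ k F) n ≡ + ∑ℕ k (λ c → g (suc c))
∑₁-coeff k F g n F≡g = trans (coeff (sumFrom-suc 0 k F) n) (∑-coeff k (λ c → F (suc c)) (λ c → g (suc c)) n (λ c → F≡g (suc c)))

module _ (k : ℕ) where

  farˢ : ℕ → ℕ → Series
  farˢ a c = const (+ far k a c)

  W : ℕ → ℕ → Series
  W a b n = + walks k n a b

  W-equation : ∀ a b → W a b ≈ farˢ a b + X * ∑[ c ∈1… k ] (farˢ a c * W c b)
  W-equation a b = coeffwise λ
    { zero    → sym (trans (+-coeff (farˢ a b) _ zero) (trans (cong (ℤ._+_ (+ far k a b)) (X*-zero _)) (ℤₚ.+-identityʳ _)))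
    ; (suc n) → sym (begin
        (farˢ a b + X * S) (suc n)        ≡⟨ +-coeff (farˢ a b) _ (suc n) ⟩
        + 0 ℤ.+ (X * S) (suc n)           ≡⟨ ℤₚ.+-identityˡ _ ⟩
        (X * S) (suc n)                   ≡⟨ X*-suc S n ⟩
        S n                               ≡⟨ ∑₁-coeff k _ _ n (λ c → trans (const*-coeff _ (W c b) n) (sym (ℤₚ.pos-* (far k a c) _))) ⟩
        W a b (suc n)                     ∎) }
    where
    open ≡-Reasoning
    S : Series
    S = ∑[ c ∈1… k ] (farˢ a c * W c b)

  -- the (a, b) entry of (I - xA)⁻¹
  N : ℕ → ℕ → Series
  N a b = δ a b + X * W a b

  N-equation : ∀ a b → 1 ℕ.≤ b → b ℕ.≤ k → N a b ≈ δ a b + X * ∑[ c ∈1… k ] (farˢ a c * N c b)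
  N-equation a b 1≤b b≤k = +-cong ≈-refl (*-cong ≈-refl (begin
    W a b
      ≈⟨ W-equation a b ⟩
    farˢ a b + X * ∑[ c ∈1… k ] (farˢ a c * W c b)
      ≈⟨ +-cong (∑₁-δ k b (farˢ a) 1≤b b≤k) ≈-refl ⟨
    ∑[ c ∈1… k ] (δ c b * farˢ a c) + X * ∑[ c ∈1… k ] (farˢ a c * W c b)
      ≈⟨ +-cong ≈-refl (*-distribˡ-sumFrom 1 k X _) ⟩
    ∑[ c ∈1… k ] (δ c b * farˢ a c) + ∑[ c ∈1… k ] (X * (farˢ a c * W c b))
      ≈⟨ sumFrom-+ 1 k _ _ ⟨
    ∑[ c ∈1… k ] (δ c b * farˢ a c + X * (farˢ a c * W c b))
      ≈⟨ ∑₁-cong k (λ c _ _ → solve 4 (λ d f x w → d :* f :+ x :* (f :* w) := f :* (d :+ x :* w)) ≈-refl (δ c b) (farˢ a c) X (W c b)) ⟩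
    ∑[ c ∈1… k ] (farˢ a c * N c b) ∎))
    where open ≈-Reasoning

near-indicator : ∀ x y → indicator (ℕ.∣ x - y ∣ ℕ.≤ᵇ 1)
                       ≡ indicator (suc y ℕ.≡ᵇ x) ℕ.+ indicator (y ℕ.≡ᵇ x) ℕ.+ indicator (y ℕ.≡ᵇ suc x)
near-indicator zero          zero          = refl
near-indicator zero          (suc zero)    = refl
near-indicator zero          (suc (suc y)) = refl
near-indicator (suc zero)    zero          = refl
near-indicator (suc (suc x)) zero          = refl
near-indicator (suc x)       (suc y)       = near-indicator x y

module _ (k : ℕ) where

  far+near : ∀ a c → farˢ k (suc a) (suc c) + (δ (suc c) a + δ (suc c) (suc a) + δ (suc c) (suc (suc a))) ≈ 1#
  far+near a c = begin
    farˢ k (suc a) (suc c) + (δ (suc c) a + δ (suc c) (suc a) + δ (suc c) (suc (suc a)))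
      ≈⟨ +-cong ≈-refl (+-cong (+-cong (δ-indicator _ _) (δ-indicator _ _)) (δ-indicator _ _)) ⟩
    const (+ indicator (not b)) + (const (+ i₁) + const (+ i₂) + const (+ i₃))
      ≈⟨ ≈-trans (+-cong ≈-refl (≈-trans (+-cong (≈-sym (const-+ i₁ i₂)) ≈-refl) (≈-sym (const-+ (i₁ ℕ.+ i₂) i₃))))
                 (≈-sym (const-+ (indicator (not b)) _)) ⟩
    const (+ (indicator (not b) ℕ.+ (i₁ ℕ.+ i₂ ℕ.+ i₃)))
      ≈⟨ ≈-cong (λ n → const (+ n)) (trans (cong (indicator (not b) ℕ.+_) (sym (near-indicator a c))) (not+id b)) ⟩
    1# ∎
    where
    open ≈-Reasoning
    b : Bool
    b = ℕ.∣ a - c ∣ ℕ.≤ᵇ 1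
    i₁ i₂ i₃ : ℕ
    i₁ = indicator (suc c ℕ.≡ᵇ a)
    i₂ = indicator (c ℕ.≡ᵇ a)
    i₃ = indicator (c ℕ.≡ᵇ suc a)
    not+id : ∀ b → indicator (not b) ℕ.+ indicator b ≡ 1
    not+id true  = refl
    not+id false = refl

  columnSum : ℕ → Series
  columnSum b = ∑[ c ∈1… k ] N k c b

  -- the complement of the relation far is the tridiagonal relation |a - c| ≤ 1
  tridiag-N : ∀ a b → 1 ℕ.≤ a → a ℕ.≤ k → 1 ℕ.≤ b → b ℕ.≤ k →
              tridiag (λ e → restrict k (λ c → N k c b) e) a ≈ δ a b + X * columnSum b
  tridiag-N (suc a) b _ a≤k 1≤b b≤k = begin
    (1# + X) * R (suc a) + X * (R a + R (suc (suc a)))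
      ≈⟨ +-cong (*-cong ≈-refl (restrict-inside k _ (suc a) (ℕ.s≤s ℕ.z≤n) a≤k)) ≈-refl ⟩
    (1# + X) * N k (suc a) b + X * (R a + R (suc (suc a)))
      ≈⟨ solve 4 (λ x n p q → (con (+ 1) :+ x) :* n :+ x :* (p :+ q) := n :+ x :* (p :+ n :+ q)) ≈-refl X _ _ _ ⟩
    N k (suc a) b + X * (R a + N k (suc a) b + R (suc (suc a)))
      ≈⟨ +-cong (≈-sym (N-equation k (suc a) b 1≤b b≤k))
                (*-cong ≈-refl (+-cong (+-cong ≈-refl (restrict-inside k _ (suc a) (ℕ.s≤s ℕ.z≤n) a≤k)) ≈-refl)) ⟨
    δ (suc a) b + X * ∑[ c ∈1… k ] (farˢ k (suc a) c * N k c b) + X * (R a + R (suc a) + R (suc (suc a)))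
      ≈⟨ solve 4 (λ d x f r → d :+ x :* f :+ x :* r := d :+ x :* (f :+ r)) ≈-refl _ X _ _ ⟩
    δ (suc a) b + X * (∑[ c ∈1… k ] (farˢ k (suc a) c * N k c b) + (R a + R (suc a) + R (suc (suc a))))
      ≈⟨ +-cong ≈-refl (*-cong ≈-refl (+-cong ≈-refl near-sum)) ⟩
    δ (suc a) b + X * (∑[ c ∈1… k ] (farˢ k (suc a) c * N k c b) + ∑[ c ∈1… k ] (near c * N k c b))
      ≈⟨ +-cong ≈-refl (*-cong ≈-refl (≈-sym (sumFrom-+ 1 k _ _))) ⟩
    δ (suc a) b + X * ∑[ c ∈1… k ] (farˢ k (suc a) c * N k c b + near c * N k c b)
      ≈⟨ +-cong ≈-refl (*-cong ≈-refl (∑₁-cong k λ { (suc c) _ _ →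
           ≈-trans (≈-sym (distribʳ (N k (suc c) b) _ _)) (≈-trans (*-cong (far+near a c) ≈-refl) (*-identityˡ _)) })) ⟩
    δ (suc a) b + X * columnSum b ∎
    where
    open ≈-Reasoning
    R : ℕ → Series
    R e = restrict k (λ c → N k c b) e
    near : ℕ → Series
    near c = δ c a + δ c (suc a) + δ c (suc (suc a))
    near-sum : R a + R (suc a) + R (suc (suc a)) ≈ ∑[ c ∈1… k ] (near c * N k c b)
    near-sum = begin
      R a + R (suc a) + R (suc (suc a))
        ≈⟨ +-cong (sumFrom-+ 1 k _ _) ≈-refl ⟨
      ∑[ c ∈1… k ] (δ c a * N k c b + δ c (suc a) * N k c b) + R (suc (suc a))
        ≈⟨ sumFrom-+ 1 k _ _ ⟨
      ∑[ c ∈1… k ] (δ c a * N k c b + δ c (suc a) * N k c b + δ c (suc (suc a)) * N k c b)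
        ≈⟨ ∑₁-cong k (λ c _ _ → solve 4 (λ p q r n → p :* n :+ q :* n :+ r :* n := (p :+ q :+ r) :* n) ≈-refl _ _ _ (N k c b)) ⟩
      ∑[ c ∈1… k ] (near c * N k c b) ∎

  cyclicGF≈ : cyclicGF k ≈ 1# + X * ∑[ a ∈1… k ] W k a a
  cyclicGF≈ = coeffwise λ
    { zero    → sym (trans (+-coeff 1# _ zero) (cong (ℤ._+_ (+ 1)) (X*-zero _)))
    ; (suc m) → sym (begin
        (1# + X * S) (suc m)                         ≡⟨ +-coeff 1# _ (suc m) ⟩
        + 0 ℤ.+ (X * S) (suc m)                      ≡⟨ ℤₚ.+-identityˡ _ ⟩
        (X * S) (suc m)                              ≡⟨ X*-suc S m ⟩
        S m                                          ≡⟨ ∑₁-coeff k (λ a → W k a a) (λ a → walks k m a a) m (λ _ → refl) ⟩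
        + ∑ℕ k (λ a → walks k m (suc a) (suc a))     ≡⟨ cong +_ (c-suc k m) ⟨
        cyclicGF k (suc m)                           ∎) }
    where
    open ≡-Reasoning
    S : Series
    S = ∑[ a ∈1… k ] W k a a

  cyclicGF-trace : cyclicGF k ≈ 1# - const (+ k) + ∑[ a ∈1… k ] N k a a
  cyclicGF-trace = begin
    cyclicGF k                                                      ≈⟨ cyclicGF≈ ⟩
    1# + X * ∑[ a ∈1… k ] W k a a
      ≈⟨ solve 3 (λ x κ w → con (+ 1) :+ x :* w := con (+ 1) :- κ :+ (κ :+ x :* w)) ≈-refl X (const (+ k)) _ ⟩
    1# - const (+ k) + (const (+ k) + X * ∑[ a ∈1… k ] W k a a)     ≈⟨ +-cong ≈-refl trace ⟨
    1# - const (+ k) + ∑[ a ∈1… k ] N k a a                         ∎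
    where
    open ≈-Reasoning
    trace : ∑[ a ∈1… k ] N k a a ≈ const (+ k) + X * ∑[ a ∈1… k ] W k a a
    trace = begin
      ∑[ a ∈1… k ] (δ a a + X * W k a a)                      ≈⟨ sumFrom-+ 1 k _ _ ⟩
      ∑[ a ∈1… k ] δ a a + ∑[ a ∈1… k ] (X * W k a a)
        ≈⟨ +-cong (sumFrom-cong 1 k λ a _ _ → δ-diag a) (≈-sym (*-distribˡ-sumFrom 1 k X _)) ⟩
      ∑[ a ∈1… k ] 1# + X * ∑[ a ∈1… k ] W k a a              ≈⟨ +-cong (≈-trans (sumFrom-const 1 k 1#) (*-identityʳ _)) ≈-refl ⟩
      const (+ k) + X * ∑[ a ∈1… k ] W k a a                  ∎

tridiag-at : ∀ f a {f₋ f₀ f₊} → f (pred a) ≈ f₋ → f a ≈ f₀ → f (suc a) ≈ f₊ → tridiag f a ≈ (1# + X) * f₀ + X * (f₋ + f₊)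
tridiag-at f a f₋≈ f₀≈ f₊≈ = +-cong (*-cong ≈-refl f₀≈) (*-cong ≈-refl (+-cong f₋≈ f₊≈))

∸-suc : ∀ {m c} → c ℕ.< m → m ∸ c ≡ suc (m ∸ suc c)
∸-suc c<m = ℕₚ.+-∸-assoc 1 c<m

-- The two homogeneous solutions of tridiag, built from v read forwards and backwards.
tridiag-descending : ∀ m a → 1 ℕ.≤ a → a ℕ.< m → tridiag (λ b → (- X) ^ (m ∸ b) * v b) a ≈ 0#
tridiag-descending m (suc a) _ a<m = begin
  tridiag f (suc a)
    ≈⟨ tridiag-at f (suc a) (*-cong (^-congʳ (- X) (trans (∸-suc (ℕₚ.<-trans (ℕₚ.n<1+n a) a<m)) (cong suc (∸-suc a<m)))) ≈-refl)
                            (*-cong (^-congʳ (- X) (∸-suc a<m)) ≈-refl) ≈-refl ⟩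
  (1# + X) * ((- X) ^ suc r * v (suc a)) + X * ((- X) ^ suc (suc r) * v a + (- X) ^ r * v (suc (suc a)))
    ≈⟨ solve 4 (λ x w a b → (con (+ 1) :+ x) :* (((:- x) :* w) :* b) :+ x :* (((:- x) :* ((:- x) :* w)) :* a :+ w :* :next x a b)
                         := con (+ 0)) ≈-refl X ((- X) ^ r) (v a) (v (suc a)) ⟩
  0# ∎
  where
  open ≈-Reasoning
  r : ℕ
  r = m ∸ suc (suc a)
  f : ℕ → Series
  f b = (- X) ^ (m ∸ b) * v b

tridiag-ascending : ∀ e m a → e ℕ.< a → a ℕ.< m → tridiag (λ b → (- X) ^ (b ∸ e) * v (m ∸ b)) a ≈ 0#
tridiag-ascending e m (suc a) (ℕ.s≤s e≤a) a<m = begin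
  tridiag f (suc a)
    ≈⟨ tridiag-at f (suc a) (*-cong ≈-refl (≈-cong v (trans (∸-suc (ℕₚ.<-trans (ℕₚ.n<1+n a) a<m)) (cong suc (∸-suc a<m)))))
                            (*-cong (^-congʳ (- X) (ℕₚ.+-∸-assoc 1 e≤a)) (≈-cong v (∸-suc a<m)))
                            (*-cong (^-congʳ (- X) (trans (ℕₚ.+-∸-assoc 1 (ℕₚ.m≤n⇒m≤1+n e≤a)) (cong suc (ℕₚ.+-∸-assoc 1 e≤a)))) ≈-refl) ⟩
  (1# + X) * ((- X) ^ suc j * v (suc r)) + X * ((- X) ^ j * v (suc (suc r)) + (- X) ^ suc (suc j) * v r)
    ≈⟨ solve 4 (λ x w a b → (con (+ 1) :+ x) :* (((:- x) :* w) :* b) :+ x :* (w :* :next x a b :+ ((:- x) :* ((:- x) :* w)) :* a)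
                         := con (+ 0)) ≈-refl X ((- X) ^ j) (v r) (v (suc r)) ⟩
  0# ∎
  where
  open ≈-Reasoning
  j r : ℕ
  j = a ∸ e
  r = m ∸ suc (suc a)
  f : ℕ → Series
  f b = (- X) ^ (b ∸ e) * v (m ∸ b)

module Green (k : ℕ) where

  V Q : Series
  V = v (suc k)
  Q = (- X) ^ (k ∸ 1)

  q p : ℕ → Series
  q a = (- X) ^ (k ∸ a) * v a
  p a = (- X) ^ (a ∸ 1) * v (suc k ∸ a)

  green : ℕ → ℕ → Series
  green d a = if a ℕ.≤ᵇ d then q a * p d else q d * p a

  green-≤ : ∀ {d a} → a ℕ.≤ d → green d a ≈ q a * p d
  green-≤ {d} {a} a≤d with a ℕ.≤ᵇ d in eq
  ... | true  = ≈-refl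
  ... | false = ⊥-elim (subst T eq (ℕₚ.≤⇒≤ᵇ a≤d))

  green-≥ : ∀ {d a} → d ℕ.≤ a → green d a ≈ q d * p a
  green-≥ {d} {a} d≤a with a ℕ.≤ᵇ d in eq
  ... | true  = ≈-trans (≈-cong (λ i → q i * p d) a≡d) (≈-cong (λ i → q d * p i) (sym a≡d))
    where
    a≡d : a ≡ d
    a≡d = ℕₚ.≤-antisym (ℕₚ.≤ᵇ⇒≤ a d (subst T (sym eq) _)) d≤a
  ... | false = ≈-refl

  green-0 : ∀ d → green d 0 ≈ 0#
  green-0 d = solve 2 (λ w y → (w :* con (+ 0)) :* y := con (+ 0)) ≈-refl ((- X) ^ k) (p d)

  green-suc : ∀ d → d ℕ.≤ k → green d (suc k) ≈ 0#
  green-suc d d≤k = begin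
    green d (suc k)                      ≈⟨ green-≥ (ℕₚ.m≤n⇒m≤1+n d≤k) ⟩
    q d * ((- X) ^ k * v (k ∸ k))        ≈⟨ *-cong ≈-refl (*-cong ≈-refl (≈-cong v (ℕₚ.n∸n≡0 k))) ⟩
    q d * ((- X) ^ k * 0#)               ≈⟨ solve 2 (λ a w → a :* (w :* con (+ 0)) := con (+ 0)) ≈-refl (q d) ((- X) ^ k) ⟩
    0#                                   ∎
    where open ≈-Reasoning

  -- a discrete Wronskian: it does not depend on d
  tridiag-green-diag : ∀ d → suc d ℕ.≤ k → tridiag (green (suc d)) (suc d) ≈ Q * V
  tridiag-green-diag d d<k = begin
    tridiag (green (suc d)) (suc d)
      ≈⟨ tridiag-at (green (suc d)) (suc d)
           (≈-trans (green-≤ (ℕₚ.n≤1+n d)) (*-cong (*-cong (^-congʳ (- X) (∸-suc d<k)) ≈-refl) (*-cong ≈-refl (≈-cong v (∸-suc d<k)))))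
           (≈-trans (green-≤ ℕₚ.≤-refl) (*-cong ≈-refl (*-cong ≈-refl (≈-cong v (∸-suc d<k)))))
           (green-≥ (ℕₚ.n≤1+n (suc d))) ⟩
    (1# + X) * ((- X) ^ r * v (suc d) * ((- X) ^ d * v (suc r)))
      + X * ((- X) ^ suc r * v d * ((- X) ^ d * v (suc r)) + (- X) ^ r * v (suc d) * ((- X) ^ suc d * v r))
      ≈⟨ solve 7 (λ x w z a b c e → (con (+ 1) :+ x) :* (w :* b :* (z :* e)) :+ x :* (((:- x) :* w) :* a :* (z :* e) :+ w :* b :* (((:- x) :* z) :* c))
                                 := (z :* w) :* (:next x a b :* e :- (x :* x) :* b :* c))
                 ≈-refl X ((- X) ^ r) ((- X) ^ d) (v d) (v (suc d)) (v r) (v (suc r)) ⟩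
    (- X) ^ d * (- X) ^ r * (v (suc (suc d)) * v (suc r) - X * X * v (suc d) * v r)
      ≈⟨ *-cong (≈-sym (^-homo-* (- X) d r)) (≈-sym (v-add (suc d) r)) ⟩
    (- X) ^ (d ℕ.+ r) * v (suc (suc d ℕ.+ r))
      ≈⟨ *-cong (^-congʳ (- X) (cong pred d+r+1≡k)) (≈-cong (λ i → v (suc i)) d+r+1≡k) ⟩
    Q * V ∎
    where
    open ≈-Reasoning
    r : ℕ
    r = k ∸ suc d
    d+r+1≡k : suc d ℕ.+ r ≡ k
    d+r+1≡k = ℕₚ.m+[n∸m]≡n d<k

  tridiag-q : ∀ a → 1 ℕ.≤ a → a ℕ.< k → tridiag q a ≈ 0#
  tridiag-q = tridiag-descending k

  tridiag-p : ∀ a → 2 ℕ.≤ a → a ℕ.≤ k → tridiag p a ≈ 0#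
  tridiag-p a 2≤a a≤k = tridiag-ascending 1 (suc k) a 2≤a (ℕ.s≤s a≤k)

  tridiag-green : ∀ d a → 1 ℕ.≤ d → d ℕ.≤ k → 1 ℕ.≤ a → a ℕ.≤ k → tridiag (green d) a ≈ δ a d * (Q * V)
  tridiag-green d a 1≤d d≤k 1≤a a≤k with ℕₚ.<-cmp a d
  ... | tri< a<d _ _ = begin
    tridiag (green d) a
      ≈⟨ tridiag-at (green d) a (green-≤ (ℕₚ.≤-trans ℕₚ.pred[n]≤n (ℕₚ.<⇒≤ a<d))) (green-≤ (ℕₚ.<⇒≤ a<d)) (green-≤ a<d) ⟩
    (1# + X) * (q a * p d) + X * (q (pred a) * p d + q (suc a) * p d)
      ≈⟨ solve 5 (λ x a₋ a₀ a₊ c → (con (+ 1) :+ x) :* (a₀ :* c) :+ x :* (a₋ :* c :+ a₊ :* c)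
                                := ((con (+ 1) :+ x) :* a₀ :+ x :* (a₋ :+ a₊)) :* c)
                 ≈-refl X (q (pred a)) (q a) (q (suc a)) (p d) ⟩
    tridiag q a * p d
      ≈⟨ *-cong (tridiag-q a 1≤a (ℕₚ.<-≤-trans a<d d≤k)) ≈-refl ⟩
    0# * p d
      ≈⟨ zeroˡ (p d) ⟩
    0#
      ≈⟨ ≈-trans (*-cong (δ-≢ (ℕₚ.<⇒≢ a<d)) ≈-refl) (zeroˡ _) ⟨
    δ a d * (Q * V) ∎
    where open ≈-Reasoning
  ... | tri≈ _ refl _ = ≈-trans (diagonal a 1≤a a≤k) (≈-sym (≈-trans (*-cong (δ-diag a) ≈-refl) (*-identityˡ _)))
    where
    diagonal : ∀ a → 1 ℕ.≤ a → a ℕ.≤ k → tridiag (green a) a ≈ Q * V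
    diagonal (suc a) _ a<k = tridiag-green-diag a a<k
  ... | tri> _ _ d<a = begin
    tridiag (green d) a
      ≈⟨ tridiag-at (green d) a (green-≥ (ℕₚ.suc[m]≤n⇒m≤pred[n] d<a)) (green-≥ (ℕₚ.<⇒≤ d<a))
                                (green-≥ (ℕₚ.m≤n⇒m≤1+n (ℕₚ.<⇒≤ d<a))) ⟩
    (1# + X) * (q d * p a) + X * (q d * p (pred a) + q d * p (suc a))
      ≈⟨ solve 5 (λ x a₋ a₀ a₊ c → (con (+ 1) :+ x) :* (c :* a₀) :+ x :* (c :* a₋ :+ c :* a₊)
                                := c :* ((con (+ 1) :+ x) :* a₀ :+ x :* (a₋ :+ a₊)))
                 ≈-refl X (p (pred a)) (p a) (p (suc a)) (q d) ⟩
    q d * tridiag p a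
      ≈⟨ *-cong ≈-refl (tridiag-p a (ℕₚ.≤-trans (ℕ.s≤s 1≤d) d<a) a≤k) ⟩
    q d * 0#
      ≈⟨ zeroʳ (q d) ⟩
    0#
      ≈⟨ ≈-trans (*-cong (δ-≢ (ℕₚ.>⇒≢ d<a)) ≈-refl) (zeroˡ _) ⟨
    δ a d * (Q * V) ∎
    where open ≈-Reasoning

  A B y : ℕ → Series
  A a = (- X) ^ a * v (suc k ∸ a)
  B a = (- X) ^ (suc k ∸ a) * v a
  -- y / ((1 + 3x) V) is the solution of tridiag with constant right-hand side 1
  y a = V - A a - B a

  y-0 : y 0 ≈ 0#
  y-0 = solve 2 (λ w p → w :- con (+ 1) :* w :- p :* con (+ 0) := con (+ 0)) ≈-refl V ((- X) ^ suc k)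

  y-suc : y (suc k) ≈ 0#
  y-suc = begin
    V - (- X) ^ suc k * v (k ∸ k) - (- X) ^ (k ∸ k) * V
      ≈⟨ +-cong (+-cong ≈-refl (-‿cong (*-cong ≈-refl (≈-cong v (ℕₚ.n∸n≡0 k)))))
                (-‿cong (*-cong (^-congʳ (- X) (ℕₚ.n∸n≡0 k)) ≈-refl)) ⟩
    V - (- X) ^ suc k * 0# - 1# * V
      ≈⟨ solve 2 (λ w p → w :- p :* con (+ 0) :- con (+ 1) :* w := con (+ 0)) ≈-refl V ((- X) ^ suc k) ⟩
    0# ∎
    where open ≈-Reasoning

  tridiag-y : ∀ a → 1 ℕ.≤ a → a ℕ.≤ k → tridiag y a ≈ 1+3X * V
  tridiag-y a 1≤a a≤k = begin
    tridiag y a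
      ≈⟨ solve 8 (λ x w a₋ a₀ a₊ b₋ b₀ b₊ → (con (+ 1) :+ x) :* (w :- a₀ :- b₀) :+ x :* ((w :- a₋ :- b₋) :+ (w :- a₊ :- b₊))
                   := :1+3X x :* w :- ((con (+ 1) :+ x) :* a₀ :+ x :* (a₋ :+ a₊)) :- ((con (+ 1) :+ x) :* b₀ :+ x :* (b₋ :+ b₊)))
                 ≈-refl X V (A (pred a)) (A a) (A (suc a)) (B (pred a)) (B a) (B (suc a)) ⟩
    1+3X * V - tridiag A a - tridiag B a
      ≈⟨ +-cong (+-cong ≈-refl (-‿cong (tridiag-ascending 0 (suc k) a 1≤a (ℕ.s≤s a≤k))))
                (-‿cong (tridiag-descending (suc k) a 1≤a (ℕ.s≤s a≤k))) ⟩
    1+3X * V - 0# - 0#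
      ≈⟨ solve 1 (λ c → c :- con (+ 0) :- con (+ 0) := c) ≈-refl (1+3X * V) ⟩
    1+3X * V ∎
    where open ≈-Reasoning

  Ncol : ℕ → ℕ → Series
  Ncol d = restrict k (λ c → N k c d)

  ∑green : ℕ → Series
  ∑green d = ∑₁ k (green d)

  Γ E : Series
  Γ = ∑₁ k y
  -- E = (1 + 3x) V (1 - x γ(x, 0))
  E = 1+3X * V - X * Γ

  Q*V*N-diag : ∀ d → 1 ℕ.≤ d → d ℕ.≤ k → Q * V * N k d d ≈ green d d + X * columnSum k d * ∑green d
  Q*V*N-diag d 1≤d d≤k = begin
    Q * V * N k d d                                         ≈⟨ *-cong ≈-refl (restrict-inside k _ d 1≤d d≤k) ⟨
    Q * V * Ncol d d                                        ≈⟨ ∑₁-δ*-* k d (Q * V) (Ncol d) 1≤d d≤k ⟨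
    ∑[ a ∈1… k ] (δ a d * (Q * V) * Ncol d a)
      ≈⟨ ∑₁-tridiag-pairing k (green d) (Ncol d) _ _ (green-0 d) (restrict-0 k _) (green-suc d d≤k) (restrict-suc k _)
                                                                 (λ a 1≤a a≤k → tridiag-green d a 1≤d d≤k 1≤a a≤k)
                                                                 (λ a 1≤a a≤k → tridiag-N k a d 1≤a a≤k 1≤d d≤k) ⟨
    ∑[ a ∈1… k ] (green d a * (δ a d + X * columnSum k d))  ≈⟨ ∑₁-*-δ+ k d (green d) (X * columnSum k d) 1≤d d≤k ⟩
    green d d + X * columnSum k d * ∑green d                ∎
    where open ≈-Reasoning

  1+3X*∑green : ∀ d → 1 ℕ.≤ d → d ℕ.≤ k → 1+3X * ∑green d ≈ Q * y d
  1+3X*∑green d 1≤d d≤k = *-cancelˡ-NonZero (NonZero-v k) (begin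
    V * (1+3X * ∑green d)                       ≈⟨ solve 3 (λ w c g → w :* (c :* g) := g :* (c :* w)) ≈-refl V 1+3X (∑green d) ⟩
    ∑green d * (1+3X * V)                       ≈⟨ *-distribʳ-sumFrom 1 k (1+3X * V) (green d) ⟩
    ∑[ a ∈1… k ] (green d a * (1+3X * V))       ≈⟨ ∑₁-tridiag-pairing k (green d) y _ _ (green-0 d) y-0 (green-suc d d≤k) y-suc
                                                     (λ a 1≤a a≤k → tridiag-green d a 1≤d d≤k 1≤a a≤k) tridiag-y ⟩
    ∑[ a ∈1… k ] (δ a d * (Q * V) * y a)        ≈⟨ ∑₁-δ*-* k d (Q * V) y 1≤d d≤k ⟩
    Q * V * y d                                 ≈⟨ solve 3 (λ q w z → q :* w :* z := w :* (q :* z)) ≈-refl Q V (y d) ⟩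
    V * (Q * y d)                               ∎)
    where open ≈-Reasoning

  E*columnSum : ∀ d → 1 ℕ.≤ d → d ℕ.≤ k → E * columnSum k d ≈ y d
  E*columnSum d 1≤d d≤k = begin
    (1+3X * V - X * Γ) * s               ≈⟨ solve 4 (λ c x g s → (c :- x :* g) :* s := c :* s :- x :* s :* g) ≈-refl (1+3X * V) X Γ s ⟩
    1+3X * V * s - X * s * Γ             ≈⟨ +-cong reflected ≈-refl ⟨
    y d + X * s * Γ - X * s * Γ          ≈⟨ solve 2 (λ a b → a :+ b :- b := a) ≈-refl (y d) (X * s * Γ) ⟩
    y d                                  ∎
    where
    open ≈-Reasoning
    s : Series
    s = columnSum k d
    reflected : y d + X * s * Γ ≈ 1+3X * V * s
    reflected = begin
      y d + X * s * Γ                           ≈⟨ ∑₁-*-δ+ k d y (X * s) 1≤d d≤k ⟨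
      ∑[ a ∈1… k ] (y a * (δ a d + X * s))      ≈⟨ ∑₁-tridiag-pairing k y (Ncol d) _ _ y-0 (restrict-0 k _) y-suc (restrict-suc k _) tridiag-y
                                                     (λ a 1≤a a≤k → tridiag-N k a d 1≤a a≤k 1≤d d≤k) ⟩
      ∑[ a ∈1… k ] (1+3X * V * Ncol d a)        ≈⟨ ∑₁-cong k (λ a 1≤a a≤k → *-cong ≈-refl (restrict-inside k _ a 1≤a a≤k)) ⟩
      ∑[ a ∈1… k ] (1+3X * V * N k a d)         ≈⟨ *-distribˡ-sumFrom 1 k (1+3X * V) _ ⟨
      1+3X * V * s                              ∎

  trace : Series
  trace = ∑[ d ∈1… k ] N k d d

  -- Sherman–Morrison for N = (tridiag - x 𝟙𝟙ᵀ)⁻¹, entry (d, d)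
  N-diag : ∀ d → 1 ℕ.≤ d → d ℕ.≤ k → E * 1+3X * (Q * V) * N k d d ≈ E * 1+3X * green d d + X * Q * (y d * y d)
  N-diag d 1≤d d≤k = begin
    E * 1+3X * (Q * V) * N k d d                     ≈⟨ *-assoc (E * 1+3X) (Q * V) (N k d d) ⟩
    E * 1+3X * (Q * V * N k d d)                     ≈⟨ *-cong ≈-refl (Q*V*N-diag d 1≤d d≤k) ⟩
    E * 1+3X * (green d d + X * s * ∑green d)        ≈⟨ solve 6 (λ e c g x s φ → e :* c :* (g :+ x :* s :* φ) := e :* c :* g :+ x :* (e :* s) :* (c :* φ))
                                                          ≈-refl E 1+3X (green d d) X s (∑green d) ⟩
    E * 1+3X * green d d + X * (E * s) * (1+3X * ∑green d)
                                                     ≈⟨ +-cong ≈-refl (*-cong (*-cong ≈-refl (E*columnSum d 1≤d d≤k)) (1+3X*∑green d 1≤d d≤k)) ⟩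
    E * 1+3X * green d d + X * y d * (Q * y d)       ≈⟨ +-cong ≈-refl (solve 3 (λ x z q → x :* z :* (q :* z) := x :* q :* (z :* z)) ≈-refl X (y d) Q) ⟩
    E * 1+3X * green d d + X * Q * (y d * y d)       ∎
    where
    open ≈-Reasoning
    s : Series
    s = columnSum k d

  trace-relation : E * 1+3X * (Q * V) * trace ≈ E * 1+3X * ∑[ d ∈1… k ] green d d + X * Q * ∑[ d ∈1… k ] (y d * y d)
  trace-relation = begin
    E * 1+3X * (Q * V) * trace                                                 ≈⟨ *-distribˡ-sumFrom 1 k _ _ ⟩
    ∑[ d ∈1… k ] (E * 1+3X * (Q * V) * N k d d)                               ≈⟨ ∑₁-cong k N-diag ⟩
    ∑[ d ∈1… k ] (E * 1+3X * green d d + X * Q * (y d * y d))                 ≈⟨ sumFrom-+ 1 k _ _ ⟩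
    ∑[ d ∈1… k ] (E * 1+3X * green d d) + ∑[ d ∈1… k ] (X * Q * (y d * y d))  ≈⟨ +-cong (*-distribˡ-sumFrom 1 k _ _) (*-distribˡ-sumFrom 1 k _ _) ⟨
    E * 1+3X * ∑[ d ∈1… k ] green d d + X * Q * ∑[ d ∈1… k ] (y d * y d)      ∎
    where open ≈-Reasoning

[-X]^-square : ∀ j → (- X) ^ j * (- X) ^ j ≈ (X * X) ^ j
[-X]^-square zero    = *-identityˡ 1#
[-X]^-square (suc j) = ≈-trans (solve 3 (λ x p q → ((:- x) :* p) :* ((:- x) :* q) := (x :* x) :* (p :* q)) ≈-refl X ((- X) ^ j) ((- X) ^ j))
                               (*-cong ≈-refl ([-X]^-square j))

module _ (k : ℕ) where
  open Green k

  A≈B-reflected : ∀ a → a ℕ.≤ suc k → A (suc k ∸ a) ≈ B a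
  A≈B-reflected a a≤1+k = *-cong ≈-refl (≈-cong v (ℕₚ.m∸[m∸n]≡n a≤1+k))

  ∑A : ∑₁ k A ≈ weightedSum (- X) v k
  ∑A = ≈-trans (∑₁-reflect k A) (∑₁-cong k λ a _ a≤k → A≈B-reflected a (ℕₚ.m≤n⇒m≤1+n a≤k))

  ∑B² : ∑[ a ∈1… k ] (B a * B a) ≈ weightedSum (X * X) (λ a → v a * v a) k
  ∑B² = ∑₁-cong k λ a _ _ → ≈-trans (solve 2 (λ p w → p :* w :* (p :* w) := (p :* p) :* (w :* w)) ≈-refl ((- X) ^ (suc k ∸ a)) (v a))
                                     (*-cong ([-X]^-square (suc k ∸ a)) ≈-refl)

  ∑A² : ∑[ a ∈1… k ] (A a * A a) ≈ weightedSum (X * X) (λ a → v a * v a) k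
  ∑A² = ≈-trans (∑₁-reflect k (λ a → A a * A a))
          (≈-trans (∑₁-cong k λ a _ a≤k → *-cong (A≈B-reflected a (ℕₚ.m≤n⇒m≤1+n a≤k)) (A≈B-reflected a (ℕₚ.m≤n⇒m≤1+n a≤k))) ∑B²)

  ∑AB : ∑[ a ∈1… k ] (A a * B a) ≈ (- X) ^ suc k * v-convolution k
  ∑AB = begin
    ∑[ a ∈1… k ] (A a * B a)
      ≈⟨ ∑₁-cong k (λ a _ a≤k → ≈-trans (solve 4 (λ p w r z → (p :* w) :* (r :* z) := (p :* r) :* (z :* w))
                                                    ≈-refl ((- X) ^ a) (v (suc k ∸ a)) ((- X) ^ (suc k ∸ a)) (v a))
                                          (*-cong (≈-trans (≈-sym (^-homo-* (- X) a (suc k ∸ a))) (^-congʳ (- X) (ℕₚ.m+[n∸m]≡n (ℕₚ.m≤n⇒m≤1+n a≤k)))) ≈-refl)) ⟩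
    ∑[ a ∈1… k ] ((- X) ^ suc k * (v a * v (suc k ∸ a)))
      ≈⟨ *-distribˡ-sumFrom 1 k _ _ ⟨
    (- X) ^ suc k * v-convolution k ∎
    where open ≈-Reasoning

  ∑green-diag : ∑[ d ∈1… k ] green d d ≈ Q * v-convolution k
  ∑green-diag = begin
    ∑[ d ∈1… k ] green d d
      ≈⟨ ∑₁-cong k (λ { (suc d) _ d<k → ≈-trans (green-≤ ℕₚ.≤-refl) (diagonal d d<k) }) ⟩
    ∑[ d ∈1… k ] (Q * (v d * v (suc k ∸ d)))
      ≈⟨ *-distribˡ-sumFrom 1 k _ _ ⟨
    Q * v-convolution k ∎
    where
    open ≈-Reasoning
    diagonal : ∀ d → suc d ℕ.≤ k → q (suc d) * p (suc d) ≈ Q * (v (suc d) * v (suc k ∸ suc d))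
    diagonal d d<k = ≈-trans (*-interchange ((- X) ^ (k ∸ suc d)) (v (suc d)) ((- X) ^ d) (v (k ∸ d)))
      (*-cong (≈-trans (≈-sym (^-homo-* (- X) (k ∸ suc d) d))
                       (^-congʳ (- X) (trans (ℕₚ.+-comm (k ∸ suc d) d) (cong pred (ℕₚ.m+[n∸m]≡n d<k))))) ≈-refl)

  Γ-closed : Γ ≈ const (+ k) * V - const (+ 2) * weightedSum (- X) v k
  Γ-closed = begin
    ∑[ a ∈1… k ] (V - A a - B a)                            ≈⟨ sumFrom-+ 1 k _ _ ⟩
    ∑[ a ∈1… k ] (V - A a) + ∑[ a ∈1… k ] (- B a)           ≈⟨ +-cong (sumFrom-+ 1 k _ _) (sumFrom-neg 1 k B) ⟩
    ∑[ a ∈1… k ] V + ∑[ a ∈1… k ] (- A a) - ∑₁ k B          ≈⟨ +-cong (+-cong (sumFrom-const 1 k V) (≈-trans (sumFrom-neg 1 k A) (-‿cong ∑A))) ≈-refl ⟩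
    const (+ k) * V - weightedSum (- X) v k - weightedSum (- X) v k
      ≈⟨ solve 3 (λ k w b → k :* w :- b :- b := k :* w :- con (+ 2) :* b) ≈-refl (const (+ k)) V (weightedSum (- X) v k) ⟩
    const (+ k) * V - const (+ 2) * weightedSum (- X) v k ∎
    where open ≈-Reasoning

  ∑y² : ∑[ a ∈1… k ] (y a * y a) ≈ const (+ k) * (V * V) - const (+ 4) * V * weightedSum (- X) v k
                                  + const (+ 2) * weightedSum (X * X) (λ a → v a * v a) k + const (+ 2) * ((- X) ^ suc k * v-convolution k)
  ∑y² = begin
    ∑[ a ∈1… k ] (y a * y a)
      ≈⟨ ∑₁-cong k (λ a _ _ → solve 3 (λ w α β → (w :- α :- β) :* (w :- α :- β)
                                            := w :* w :+ (α :* α :+ β :* β :+ (con (+ 2) :* (α :* β) :+ (con (ℤ.- (+ 2)) :* w) :* (α :+ β))))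
                                  ≈-refl V (A a) (B a)) ⟩
    ∑[ a ∈1… k ] (V * V + (A a * A a + B a * B a + (const (+ 2) * (A a * B a) + const (ℤ.- (+ 2)) * V * (A a + B a))))
      ≈⟨ ≈-trans (sumFrom-+ 1 k _ _) (+-cong ≈-refl (≈-trans (sumFrom-+ 1 k _ _) (+-cong (sumFrom-+ 1 k _ _)
                 (≈-trans (sumFrom-+ 1 k _ _) (+-cong (≈-sym (*-distribˡ-sumFrom 1 k _ _))
                          (≈-trans (≈-sym (*-distribˡ-sumFrom 1 k _ _)) (*-cong ≈-refl (sumFrom-+ 1 k A B)))))))) ⟩
    ∑[ a ∈1… k ] (V * V) + (∑[ a ∈1… k ] (A a * A a) + ∑[ a ∈1… k ] (B a * B a)
      + (const (+ 2) * ∑[ a ∈1… k ] (A a * B a) + const (ℤ.- (+ 2)) * V * (∑₁ k A + ∑₁ k B)))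
      ≈⟨ +-cong (sumFrom-const 1 k (V * V)) (+-cong (+-cong ∑A² ∑B²) (+-cong (*-cong ≈-refl ∑AB) (*-cong ≈-refl (+-cong ∑A ≈-refl)))) ⟩
    const (+ k) * (V * V) + (B2 + B2 + (const (+ 2) * ((- X) ^ suc k * v-convolution k) + const (ℤ.- (+ 2)) * V * (Bs + Bs)))
      ≈⟨ solve 5 (λ κ w b b₂ c → κ :* (w :* w) :+ (b₂ :+ b₂ :+ (con (+ 2) :* c :+ con (ℤ.- (+ 2)) :* w :* (b :+ b)))
                             := κ :* (w :* w) :- con (+ 4) :* w :* b :+ con (+ 2) :* b₂ :+ con (+ 2) :* c)
                 ≈-refl (const (+ k)) V Bs B2 ((- X) ^ suc k * v-convolution k) ⟩
    const (+ k) * (V * V) - const (+ 4) * V * Bs + const (+ 2) * B2 + const (+ 2) * ((- X) ^ suc k * v-convolution k) ∎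
    where
    open ≈-Reasoning
    Bs B2 : Series
    Bs = weightedSum (- X) v k
    B2 = weightedSum (X * X) (λ a → v a * v a) k

-- Polynomials in the atoms x, k, V = v (k + 1), W = v k and Q = (-x)^(k - 1), with P = (-x)^k.
-- :ratioN, :γN, … are the numerators of the subexpressions ratio, γ, … of the right-hand side
-- (see RHS-representation); :D is the common denominator.
:x :κ :V :W :Q : Polynomial 5
:x = var (# 0)
:κ = var (# 1)
:V = var (# 2)
:W = var (# 3)
:Q = var (# 4)

:P :P′ :1-3x :ratioN :γN :1-xγN :1-xβN :innerN :bracketN :D : Polynomial 5
:P        = (:- :x) :* :Q
:P′       = (:- :x) :* :P
:1-3x     = con (+ 1) :- con (+ 3) :* :x
:ratioN   = :V :+ :x :* :W :- :P
:γN       = :κ :* :1+3X :x :* :V :+ con (+ 2) :* :x :* :ratioN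
:1-xγN    = :1+3X :x :* :1+3X :x :* :V :- :x :* :γN
:1-xβN    = :P :* :1+3X :x :- :x :* ((con (+ 1) :+ :κ) :* :P :- :V)
:innerN   = :1-xβN :* :1+3X :x :* :V :- :x :* :W :* :1-xγN :- :P :* :1-xγN
:bracketN = :1+3X :x :* :1+3X :x :* :V :* :1-3x :* :V :+ con (+ 2) :* :x :* (:κ :+ con (+ 1)) :* :innerN
            :- :κ :* :x :* (:1-3x :* :V :* :1-xγN) :- :1-3x :* :V :* :1-xγN
:D        = :1+3X :x :* (con (+ 1) :- :x) :* :V :* :1-xγN

-- discr · v-convolution k, (1 + 3x) · weightedSum (-x) v k, discr · weightedSum x² v² k,
-- discr · ∑ y², and the left-hand side of Cassini's identity
:lucasₖ :Sc :Bc :B2c :Yc :cassini : Polynomial 5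
:lucasₖ  = :lucas :x :W :V
:Sc      = :κ :* :lucasₖ :- con (+ 2) :* (:x :* :x) :* :W
:Bc      = :- (:x :* :V :+ :x :* :x :* :W :+ :P′)
:B2c     = :x :* :x :* :W :* :lucasₖ :- con (+ 2) :* :κ :* (:P′ :* :P′)
:Yc      = :κ :* (:V :* :V) :* :discr :x :- con (+ 4) :* :V :* ((con (+ 1) :- :x) :* :Bc) :+ con (+ 2) :* :B2c :+ con (+ 2) :* (:P′ :* :Sc)
:cassini = :V :* :V :- :W :* :next :x :W :V :- :P :* :P

module ClosedForm (k₁ : ℕ) where
  ρ : Vec Series 5
  ρ = X ∷ const (+ (suc k₁)) ∷ v (suc (suc k₁)) ∷ v (suc k₁) ∷ (- X) ^ k₁ ∷ []

  ⟪_⟫ : Polynomial 5 → Series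
  ⟪ p ⟫ = ⟦ p ⟧ ρ

  open Green (suc k₁)

  1+3X*Γ : 1+3X * Γ ≈ ⟪ :γN ⟫
  1+3X*Γ = begin
    1+3X * Γ
      ≈⟨ *-cong ≈-refl (Γ-closed (suc k₁)) ⟩
    1+3X * (const (+ (suc k₁)) * V - const (+ 2) * weightedSum (- X) v (suc k₁))
      ≈⟨ solve 4 (λ a κ w b → a :* (κ :* w :- con (+ 2) :* b) := κ :* a :* w :- con (+ 2) :* (a :* b)) ≈-refl 1+3X (const (+ (suc k₁))) V _ ⟩
    const (+ (suc k₁)) * 1+3X * V - const (+ 2) * (1+3X * weightedSum (- X) v (suc k₁))
      ≈⟨ +-cong ≈-refl (-‿cong (*-cong ≈-refl (1+3X*weightedSum-v (suc k₁)))) ⟩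
    ⟪ :κ :* :1+3X :x :* :V :- con (+ 2) :* :Bc ⟫
      ≈⟨ prove ρ (:κ :* :1+3X :x :* :V :- con (+ 2) :* :Bc) :γN ≈-refl ⟩
    ⟪ :γN ⟫ ∎
    where open ≈-Reasoning

  E*1+3X : E * 1+3X ≈ ⟪ :1-xγN ⟫
  E*1+3X = begin
    (1+3X * V - X * Γ) * 1+3X             ≈⟨ solve 4 (λ a w x g → (a :* w :- x :* g) :* a := a :* a :* w :- x :* (a :* g)) ≈-refl 1+3X V X Γ ⟩
    1+3X * 1+3X * V - X * (1+3X * Γ)      ≈⟨ +-cong ≈-refl (-‿cong (*-cong ≈-refl 1+3X*Γ)) ⟩
    ⟪ :1-xγN ⟫                            ∎
    where open ≈-Reasoning

  private
    S Bs B2 Y : Series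
    S  = v-convolution (suc k₁)
    Bs = weightedSum (- X) v (suc k₁)
    B2 = weightedSum (X * X) (λ a → v a * v a) (suc k₁)
    Y  = const (+ (suc k₁)) * (V * V) - const (+ 4) * V * Bs + const (+ 2) * B2 + const (+ 2) * ((- X) ^ suc (suc k₁) * S)

  trace-relation-reduced : E * 1+3X * V * trace ≈ E * 1+3X * S + X * Y
  trace-relation-reduced = *-cancelˡ-NonZero (NonZero-[-X]^ k₁) (begin
    Q * (E * 1+3X * V * trace)                  ≈⟨ solve 5 (λ q e a w t → q :* (e :* a :* w :* t) := e :* a :* (q :* w) :* t) ≈-refl Q E 1+3X V trace ⟩
    E * 1+3X * (Q * V) * trace                  ≈⟨ trace-relation ⟩
    E * 1+3X * ∑[ d ∈1… (suc k₁) ] green d d + X * Q * ∑[ d ∈1… (suc k₁) ] (y d * y d)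
                                                ≈⟨ +-cong (*-cong ≈-refl (∑green-diag (suc k₁))) (*-cong ≈-refl (∑y² (suc k₁))) ⟩
    E * 1+3X * (Q * S) + X * Q * Y              ≈⟨ solve 6 (λ q e a s x y → e :* a :* (q :* s) :+ x :* q :* y := q :* (e :* a :* s :+ x :* y)) ≈-refl Q E 1+3X S X Y ⟩
    Q * (E * 1+3X * S + X * Y)                  ∎)
    where open ≈-Reasoning

  discr*Y : discr * Y ≈ ⟪ :Yc ⟫
  discr*Y = begin
    discr * Y
      ≈⟨ solve 7 (λ x κ w b b₂ p s → :discr x :* (κ :* (w :* w) :- con (+ 4) :* w :* b :+ con (+ 2) :* b₂ :+ con (+ 2) :* (p :* s))
                                  := κ :* (w :* w) :* :discr x :- con (+ 4) :* w :* ((con (+ 1) :- x) :* (:1+3X x :* b))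
                                     :+ con (+ 2) :* (:discr x :* b₂) :+ con (+ 2) :* (p :* (:discr x :* s)))
                 ≈-refl X (const (+ (suc k₁))) V Bs B2 ((- X) ^ suc (suc k₁)) S ⟩
    const (+ (suc k₁)) * (V * V) * discr - const (+ 4) * V * ((1# - X) * (1+3X * Bs))
      + const (+ 2) * (discr * B2) + const (+ 2) * ((- X) ^ suc (suc k₁) * (discr * S))
      ≈⟨ +-cong (+-cong (+-cong ≈-refl (-‿cong (*-cong ≈-refl (*-cong ≈-refl (1+3X*weightedSum-v (suc k₁))))))
                        (*-cong ≈-refl (discr*weightedSum-v² (suc k₁))))
                (*-cong ≈-refl (*-cong ≈-refl (discr*v-convolution (suc k₁)))) ⟩
    ⟪ :Yc ⟫ ∎
    where open ≈-Reasoning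

  trace-closed : ⟪ :D ⟫ * trace ≈ ⟪ :1-xγN ⟫ * ⟪ :Sc ⟫ + X * ⟪ :Yc ⟫
  trace-closed = begin
    ⟪ :D ⟫ * trace
      ≈⟨ *-cong (*-cong ≈-refl E*1+3X) ≈-refl ⟨
    1+3X * (1# - X) * V * (E * 1+3X) * trace
      ≈⟨ solve 4 (λ x w e t → :1+3X x :* (con (+ 1) :- x) :* w :* (e :* :1+3X x) :* t := :discr x :* (e :* :1+3X x :* w :* t)) ≈-refl X V E trace ⟩
    discr * (E * 1+3X * V * trace)
      ≈⟨ *-cong ≈-refl trace-relation-reduced ⟩
    discr * (E * 1+3X * S + X * Y)
      ≈⟨ solve 6 (λ d e s x y a → d :* (e :* a :* s :+ x :* y) := e :* a :* (d :* s) :+ x :* (d :* y)) ≈-refl discr E S X Y 1+3X ⟩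
    E * 1+3X * (discr * S) + X * (discr * Y)
      ≈⟨ +-cong (*-cong E*1+3X (discr*v-convolution (suc k₁))) (*-cong ≈-refl discr*Y) ⟩
    ⟪ :1-xγN ⟫ * ⟪ :Sc ⟫ + X * ⟪ :Yc ⟫ ∎
    where open ≈-Reasoning

  cassini≈0 : ⟪ :cassini ⟫ ≈ 0#
  cassini≈0 = x≈y⇒x∙y⁻¹≈ε (v-cassini (suc k₁))

  -- (1 - k) D + D · trace = D + bracketN holds modulo Cassini's identity
  cyclicGF*D : cyclicGF (suc k₁) * ⟪ :D ⟫ ≈ ⟪ :D ⟫ + ⟪ :bracketN ⟫
  cyclicGF*D = begin
    cyclicGF (suc k₁) * ⟪ :D ⟫
      ≈⟨ *-cong (cyclicGF-trace (suc k₁)) ≈-refl ⟩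
    (1# - const (+ (suc k₁)) + trace) * ⟪ :D ⟫
      ≈⟨ solve 3 (λ κ t d → (con (+ 1) :- κ :+ t) :* d := (con (+ 1) :- κ) :* d :+ d :* t) ≈-refl (const (+ (suc k₁))) trace ⟪ :D ⟫ ⟩
    (1# - const (+ (suc k₁))) * ⟪ :D ⟫ + ⟪ :D ⟫ * trace
      ≈⟨ +-cong ≈-refl trace-closed ⟩
    ⟪ (con (+ 1) :- :κ) :* :D :+ (:1-xγN :* :Sc :+ :x :* :Yc) ⟫
      ≈⟨ prove ρ ((con (+ 1) :- :κ) :* :D :+ (:1-xγN :* :Sc :+ :x :* :Yc)) (:D :+ :bracketN :+ con (ℤ.- (+ 4)) :* (:x :* :x :* :x) :* :cassini) ≈-refl ⟩
    ⟪ :D ⟫ + ⟪ :bracketN ⟫ + const (ℤ.- (+ 4)) * (X * X * X) * ⟪ :cassini ⟫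
      ≈⟨ +-cong ≈-refl (≈-trans (*-cong ≈-refl cassini≈0) (zeroʳ _)) ⟩
    ⟪ :D ⟫ + ⟪ :bracketN ⟫ + 0#
      ≈⟨ +-identityʳ _ ⟩
    ⟪ :D ⟫ + ⟪ :bracketN ⟫ ∎
    where open ≈-Reasoning

⊕≈+ : ∀ f g → f ⊕ g ≈ f + g
⊕≈+ f g = coeffwise λ n → sym (+-coeff f g n)

⊗≈* : ∀ f g → f ⊗ g ≈ f * g
⊗≈* f g = coeffwise λ n → sym (*-coeff f g n)

⊖≈- : ∀ f → ⊖ f ≈ - f
⊖≈- f = coeffwise λ n → sym (neg-coeff f n)

infix 4 _≃_/_
record _≃_/_ (p : Frac) (n d : Series) : Set where
  constructor represents
  field
    factor  : Series
    nonzero : NonZero factor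
    num≈    : num p ≈ factor * n
    den≈    : den p ≈ factor * d

≃-ser : ∀ f → ser f ≃ f / 1#
≃-ser f = represents 1# (const≢0⇒NonZero λ ()) (≈-sym (*-identityˡ f)) (≈-sym (*-identityˡ 1#))

≃-resp : ∀ {p n d n′ d′} → p ≃ n / d → n ≈ n′ → d ≈ d′ → p ≃ n′ / d′
≃-resp (represents z z≢0 num≈ den≈) n≈ d≈ = represents z z≢0 (≈-trans num≈ (*-cong ≈-refl n≈)) (≈-trans den≈ (*-cong ≈-refl d≈))

≃-cancel : ∀ {p n d} w {n′ d′} → NonZero w → p ≃ n / d → n ≈ w * n′ → d ≈ w * d′ → p ≃ n′ / d′
≃-cancel w w≢0 (represents z z≢0 num≈ den≈) n≈ d≈ = represents (z * w) (NonZero-* z≢0 w≢0)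
  (≈-trans num≈ (≈-trans (*-cong ≈-refl n≈) (≈-sym (*-assoc z w _))))
  (≈-trans den≈ (≈-trans (*-cong ≈-refl d≈) (≈-sym (*-assoc z w _))))

≃-+ : ∀ {p q n₁ d₁ n₂ d₂} → p ≃ n₁ / d₁ → q ≃ n₂ / d₂ → p +F q ≃ n₁ * d₂ + n₂ * d₁ / d₁ * d₂
≃-+ {p} {q} {n₁} {d₁} {n₂} {d₂} (represents z₁ z₁≢0 num₁ den₁) (represents z₂ z₂≢0 num₂ den₂) =
  represents (z₁ * z₂) (NonZero-* z₁≢0 z₂≢0)
    (begin
      (num p ⊗ den q) ⊕ (num q ⊗ den p)    ≈⟨ ≈-trans (⊕≈+ _ _) (+-cong (⊗≈* _ _) (⊗≈* _ _)) ⟩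
      num p * den q + num q * den p        ≈⟨ +-cong (*-cong num₁ den₂) (*-cong num₂ den₁) ⟩
      z₁ * n₁ * (z₂ * d₂) + z₂ * n₂ * (z₁ * d₁)
        ≈⟨ solve 6 (λ a b c d e f → a :* c :* (b :* f) :+ b :* e :* (a :* d) := a :* b :* (c :* f :+ e :* d)) ≈-refl z₁ z₂ n₁ d₁ n₂ d₂ ⟩
      z₁ * z₂ * (n₁ * d₂ + n₂ * d₁)        ∎)
    (≈-trans (⊗≈* _ _) (≈-trans (*-cong den₁ den₂) (*-interchange z₁ d₁ z₂ d₂)))
  where open ≈-Reasoning

≃-neg : ∀ {p n d} → p ≃ n / d → -F p ≃ - n / d
≃-neg {p} {n} (represents z z≢0 num≈ den≈) =
  represents z z≢0 (≈-trans (⊖≈- _) (≈-trans (-‿cong num≈) (solve 2 (λ z n → :- (z :* n) := z :* (:- n)) ≈-refl z n))) den≈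

≃-sub : ∀ {p q n₁ d₁ n₂ d₂} → p ≃ n₁ / d₁ → q ≃ n₂ / d₂ → p -F q ≃ n₁ * d₂ + - n₂ * d₁ / d₁ * d₂
≃-sub p≃ q≃ = ≃-+ p≃ (≃-neg q≃)

≃-* : ∀ {p q n₁ d₁ n₂ d₂} → p ≃ n₁ / d₁ → q ≃ n₂ / d₂ → p *F q ≃ n₁ * n₂ / d₁ * d₂
≃-* {n₁ = n₁} {d₁} {n₂} {d₂} (represents z₁ z₁≢0 num₁ den₁) (represents z₂ z₂≢0 num₂ den₂) =
  represents (z₁ * z₂) (NonZero-* z₁≢0 z₂≢0)
    (≈-trans (⊗≈* _ _) (≈-trans (*-cong num₁ num₂) (*-interchange z₁ n₁ z₂ n₂)))
    (≈-trans (⊗≈* _ _) (≈-trans (*-cong den₁ den₂) (*-interchange z₁ d₁ z₂ d₂)))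

≃-/ : ∀ {p q n₁ d₁ n₂ d₂} → p ≃ n₁ / d₁ → q ≃ n₂ / d₂ → p /F q ≃ n₁ * d₂ / d₁ * n₂
≃-/ {n₁ = n₁} {d₁} {n₂} {d₂} (represents z₁ z₁≢0 num₁ den₁) (represents z₂ z₂≢0 num₂ den₂) =
  represents (z₁ * z₂) (NonZero-* z₁≢0 z₂≢0)
    (≈-trans (⊗≈* _ _) (≈-trans (*-cong num₁ den₂) (*-interchange z₁ n₁ z₂ d₂)))
    (≈-trans (⊗≈* _ _) (≈-trans (*-cong den₁ num₂) (*-interchange z₁ d₁ z₂ n₂)))

≃-nat : ∀ n → nat n ≃ const (+ n) / 1#
≃-nat n = ≃-ser (const (+ n))

≃-x : x ≃ X / 1#
≃-x = ≃-ser X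

≃-ψ : ∀ k → ψ k ≃ - (1# + X) / const (+ 2) * X
≃-ψ k = ≃-neg (≃-resp (≃-/ (≃-+ (≃-nat 1) ≃-x) (≃-* (≃-nat 2) ≃-x))
  (solve 1 (λ x → (con (+ 1) :* con (+ 1) :+ x :* con (+ 1)) :* (con (+ 1) :* con (+ 1)) := con (+ 1) :+ x) ≈-refl X)
  (solve 1 (λ x → con (+ 1) :* con (+ 1) :* (con (+ 2) :* x) := con (+ 2) :* x) ≈-refl X))

≃-chebU : ∀ k n → chebU n (ψ k) ≃ v (suc n) / (- X) ^ n
≃-chebU k zero          = ≃-nat 1
≃-chebU k (suc zero)    = ≃-cancel (const (ℤ.- (+ 2))) (const≢0⇒NonZero λ ()) (≃-* (≃-nat 2) (≃-ψ k))
  (solve 1 (λ x → con (+ 2) :* (:- (con (+ 1) :+ x)) := con (ℤ.- (+ 2)) :* :next x (con (+ 0)) (con (+ 1))) ≈-refl X)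
  (solve 1 (λ x → con (+ 1) :* (con (+ 2) :* x) := con (ℤ.- (+ 2)) :* ((:- x) :* con (+ 1))) ≈-refl X)
≃-chebU k (suc (suc n)) = ≃-cancel (const (ℤ.- (+ 2)) * (- X) ^ n) (NonZero-* (const≢0⇒NonZero λ ()) (NonZero-[-X]^ n))
  (≃-sub (≃-* (≃-* (≃-nat 2) (≃-ψ k)) (≃-chebU k (suc n))) (≃-chebU k n))
  (solve 4 (λ x a b w → con (+ 2) :* (:- (con (+ 1) :+ x)) :* :next x a b :* w :+ :- b :* (con (+ 1) :* (con (+ 2) :* x) :* ((:- x) :* w))
                     := con (ℤ.- (+ 2)) :* w :* :next x b (:next x a b)) ≈-refl X (v n) (v (suc n)) ((- X) ^ n))
  (solve 2 (λ x w → con (+ 1) :* (con (+ 2) :* x) :* ((:- x) :* w) :* w := con (ℤ.- (+ 2)) :* w :* ((:- x) :* ((:- x) :* w))) ≈-refl X ((- X) ^ n))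

-- the numerator/denominator pairs produced by ≃-+, ≃--, ≃-* and ≃-/, in the syntax of the solver
infixl 6 _:+ᶠ_ _:-ᶠ_
infixl 7 _:*ᶠ_ _:/ᶠ_
_:+ᶠ_ _:-ᶠ_ _:*ᶠ_ _:/ᶠ_ : Polynomial 5 × Polynomial 5 → Polynomial 5 × Polynomial 5 → Polynomial 5 × Polynomial 5
(n₁ , d₁) :+ᶠ (n₂ , d₂) = n₁ :* d₂ :+ n₂ :* d₁ , d₁ :* d₂
(n₁ , d₁) :-ᶠ (n₂ , d₂) = n₁ :* d₂ :+ :- n₂ :* d₁ , d₁ :* d₂
(n₁ , d₁) :*ᶠ (n₂ , d₂) = n₁ :* n₂ , d₁ :* d₂
(n₁ , d₁) :/ᶠ (n₂ , d₂) = n₁ :* d₂ , d₁ :* n₂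

:natᶠ : ℕ → Polynomial 5 × Polynomial 5
:natᶠ n = con (+ n) , con (+ 1)

:xᶠ :κᶠ :1+3xᶠ :1-3xᶠ :1-xᶠ :Uᶠ :U₋ᶠ : Polynomial 5 × Polynomial 5
:xᶠ    = :x , con (+ 1)
:κᶠ    = :κ , con (+ 1)
:1+3xᶠ = :1+3X :x , con (+ 1)
:1-3xᶠ = :1-3x , con (+ 1)
:1-xᶠ  = con (+ 1) :- :x , con (+ 1)
:Uᶠ    = :V , :P
:U₋ᶠ   = :W , :Q

module RHS-representation (k₁ : ℕ) where
  open ClosedForm k₁

  ≃-normalise : ∀ {p} (raw : Polynomial 5 × Polynomial 5) (w : Polynomial 5) (target : Polynomial 5 × Polynomial 5) →
                NonZero ⟪ w ⟫ → p ≃ ⟪ proj₁ raw ⟫ / ⟪ proj₂ raw ⟫ →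
                ⟦ proj₁ raw ⟧↓ ρ ≈ ⟦ w :* proj₁ target ⟧↓ ρ → ⟦ proj₂ raw ⟧↓ ρ ≈ ⟦ w :* proj₂ target ⟧↓ ρ →
                p ≃ ⟪ proj₁ target ⟫ / ⟪ proj₂ target ⟫
  ≃-normalise (n , d) w (n′ , d′) w≢0 p≃ n≈ d≈ = ≃-cancel ⟪ w ⟫ w≢0 p≃ (prove ρ n (w :* n′) n≈) (prove ρ d (w :* d′) d≈)

  one≢0 : NonZero ⟪ con (+ 1) ⟫
  one≢0 = const≢0⇒NonZero λ ()

  -- each of these is (constant term ±1) + x · (something)
  1+3X≢0 : NonZero ⟪ :1+3X :x ⟫
  1+3X≢0 = NonZero-resp-≈ (solve 1 (λ x → con (+ 1) :+ x :* con (+ 3) := :1+3X x) ≈-refl X) (NonZero-+X* 1# (const (+ 3)) λ ())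

  1-3X≢0 : NonZero ⟪ :1-3x ⟫
  1-3X≢0 = NonZero-resp-≈ (prove ρ (con (+ 1) :+ :x :* con (ℤ.- (+ 3))) :1-3x ≈-refl) (NonZero-+X* 1# (const (ℤ.- (+ 3))) λ ())

  1-xγN≢0 : NonZero ⟪ :1-xγN ⟫
  1-xγN≢0 = NonZero-resp-≈ (prove ρ (:V :+ :x :* (con (+ 6) :* :V :+ con (+ 9) :* :x :* :V :- :γN)) :1-xγN ≈-refl)
                        (NonZero-+X* ⟪ :V ⟫ _ (λ V₀≡0 → case trans (sym (v-const-term (suc k₁))) V₀≡0 of λ ()))

  D≢0 : NonZero ⟪ :D ⟫
  D≢0 = NonZero-* (NonZero-* (NonZero-* 1+3X≢0 1-X≢0) (NonZero-v (suc k₁))) 1-xγN≢0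
    where
    1-X≢0 : NonZero ⟪ con (+ 1) :- :x ⟫
    1-X≢0 = NonZero-resp-≈ (prove ρ (con (+ 1) :+ :x :* con (ℤ.- (+ 1))) (con (+ 1) :- :x) ≈-refl) (NonZero-+X* 1# (const ℤ.-1ℤ) λ ())

  ratio 1-xγ 1-xβ inner c₂ bracket prefactor : Frac
  ratio     = (Uk (suc k₁) -F Uk-1 (suc k₁) -F nat 1) /F Uk (suc k₁)
  1-xγ      = nat 1 -F x *F γ (suc k₁)
  1-xβ      = nat 1 -F x *F ((nat 1 +F nat (suc k₁) -F Uk (suc k₁)) /F 1+3x (suc k₁))
  inner     = 1-xβ /F 1-xγ +F Uk-1 (suc k₁) -F nat 1
  c₂        = (nat 2 *F x *F nat (suc (suc k₁))) /F (1-3x (suc k₁) *F Uk (suc k₁))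
  bracket   = nat 1 /F 1-xγ +F c₂ *F inner -F nat (suc k₁) *F x -F nat 1
  prefactor = 1-3x (suc k₁) /F (1+3x (suc k₁) *F 1-x (suc k₁))

  :κ+1ᶠ :ratioᶠ :γᶠ :1-xγᶠ :1-xβᶠ :innerᶠ :c₂ᶠ :c₂*innerᶠ :bracketᶠ :prefactorᶠ : Polynomial 5 × Polynomial 5
  :κ+1ᶠ       = :κ :+ con (+ 1) , con (+ 1)
  :ratioᶠ     = :ratioN , :V
  :γᶠ         = :γN , :1+3X :x :* :1+3X :x :* :V
  :1-xγᶠ      = :1-xγN , :1+3X :x :* :1+3X :x :* :V
  :1-xβᶠ      = :1-xβN , :1+3X :x :* :P
  :innerᶠ     = :innerN , :P :* :1-xγN
  :c₂ᶠ        = con (+ 2) :* :x :* (:κ :+ con (+ 1)) :* :P , :1-3x :* :V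
  :c₂*innerᶠ  = con (+ 2) :* :x :* (:κ :+ con (+ 1)) :* :innerN , :1-3x :* :V :* :1-xγN
  :bracketᶠ   = :bracketN , :1-3x :* :V :* :1-xγN
  :prefactorᶠ = :1-3x , :1+3X :x :* (con (+ 1) :- :x)

  U-≃ : Uk (suc k₁) ≃ ⟪ :V ⟫ / ⟪ :P ⟫
  U-≃ = ≃-chebU (suc k₁) (suc k₁)

  U₋-≃ : Uk-1 (suc k₁) ≃ ⟪ :W ⟫ / ⟪ :Q ⟫
  U₋-≃ = ≃-chebU (suc k₁) k₁

  1+3x-≃ : 1+3x (suc k₁) ≃ 1+3X / 1#
  1+3x-≃ = ≃-normalise (:natᶠ 1 :+ᶠ :natᶠ 3 :*ᶠ :xᶠ) (con (+ 1)) :1+3xᶠ one≢0 (≃-+ (≃-nat 1) (≃-* (≃-nat 3) ≃-x)) ≈-refl ≈-refl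

  1-3x-≃ : 1-3x (suc k₁) ≃ ⟪ :1-3x ⟫ / 1#
  1-3x-≃ = ≃-normalise (:natᶠ 1 :-ᶠ :natᶠ 3 :*ᶠ :xᶠ) (con (+ 1)) :1-3xᶠ one≢0 (≃-sub (≃-nat 1) (≃-* (≃-nat 3) ≃-x)) ≈-refl ≈-refl

  1-x-≃ : 1-x (suc k₁) ≃ 1# - X / 1#
  1-x-≃ = ≃-normalise (:natᶠ 1 :-ᶠ :xᶠ) (con (+ 1)) :1-xᶠ one≢0 (≃-sub (≃-nat 1) ≃-x) ≈-refl ≈-refl

  ratio-≃ : ratio ≃ ⟪ :ratioN ⟫ / ⟪ :V ⟫
  ratio-≃ = ≃-normalise ((:Uᶠ :-ᶠ :U₋ᶠ :-ᶠ :natᶠ 1) :/ᶠ :Uᶠ) (:Q :* :P) :ratioᶠ (NonZero-* (NonZero-[-X]^ k₁) (NonZero-[-X]^ (suc k₁)))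
    (≃-/ (≃-sub (≃-sub U-≃ U₋-≃) (≃-nat 1)) U-≃) ≈-refl ≈-refl

  γ-≃ : γ (suc k₁) ≃ ⟪ :γN ⟫ / ⟪ :1+3X :x :* :1+3X :x :* :V ⟫
  γ-≃ = ≃-normalise (:κᶠ :/ᶠ :1+3xᶠ :+ᶠ :natᶠ 2 :*ᶠ :xᶠ :/ᶠ (:1+3xᶠ :*ᶠ :1+3xᶠ) :*ᶠ :ratioᶠ) (:1+3X :x) :γᶠ 1+3X≢0
    (≃-+ (≃-/ (≃-nat (suc k₁)) 1+3x-≃) (≃-* (≃-/ (≃-* (≃-nat 2) ≃-x) (≃-* 1+3x-≃ 1+3x-≃)) ratio-≃)) ≈-refl ≈-refl

  1-xγ-≃ : 1-xγ ≃ ⟪ :1-xγN ⟫ / ⟪ :1+3X :x :* :1+3X :x :* :V ⟫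
  1-xγ-≃ = ≃-normalise (:natᶠ 1 :-ᶠ :xᶠ :*ᶠ :γᶠ) (con (+ 1)) :1-xγᶠ one≢0 (≃-sub (≃-nat 1) (≃-* ≃-x γ-≃)) ≈-refl ≈-refl

  1-xβ-≃ : 1-xβ ≃ ⟪ :1-xβN ⟫ / ⟪ :1+3X :x :* :P ⟫
  1-xβ-≃ = ≃-normalise (:natᶠ 1 :-ᶠ :xᶠ :*ᶠ ((:natᶠ 1 :+ᶠ :κᶠ :-ᶠ :Uᶠ) :/ᶠ :1+3xᶠ)) (con (+ 1)) :1-xβᶠ one≢0
    (≃-sub (≃-nat 1) (≃-* ≃-x (≃-/ (≃-sub (≃-+ (≃-nat 1) (≃-nat (suc k₁))) U-≃) 1+3x-≃))) ≈-refl ≈-refl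

  inner-≃ : inner ≃ ⟪ :innerN ⟫ / ⟪ :P :* :1-xγN ⟫
  inner-≃ = ≃-normalise (:1-xβᶠ :/ᶠ :1-xγᶠ :+ᶠ :U₋ᶠ :-ᶠ :natᶠ 1) (:1+3X :x :* :Q) :innerᶠ (NonZero-* 1+3X≢0 (NonZero-[-X]^ k₁))
    (≃-sub (≃-+ (≃-/ 1-xβ-≃ 1-xγ-≃) U₋-≃) (≃-nat 1)) ≈-refl ≈-refl

  c₂-≃ : c₂ ≃ ⟪ proj₁ :c₂ᶠ ⟫ / ⟪ proj₂ :c₂ᶠ ⟫
  c₂-≃ = ≃-normalise (:natᶠ 2 :*ᶠ :xᶠ :*ᶠ :κ+1ᶠ :/ᶠ (:1-3xᶠ :*ᶠ :Uᶠ)) (con (+ 1)) :c₂ᶠ one≢0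
    (≃-/ (≃-* (≃-* (≃-nat 2) ≃-x) (≃-resp (≃-nat (suc (suc k₁))) (≈-trans (const-+ 1 (suc k₁)) (+-comm _ _)) ≈-refl)) (≃-* 1-3x-≃ U-≃))
    ≈-refl ≈-refl

  c₂*inner-≃ : c₂ *F inner ≃ ⟪ proj₁ :c₂*innerᶠ ⟫ / ⟪ proj₂ :c₂*innerᶠ ⟫
  c₂*inner-≃ = ≃-normalise (:c₂ᶠ :*ᶠ :innerᶠ) :P :c₂*innerᶠ (NonZero-[-X]^ (suc k₁)) (≃-* c₂-≃ inner-≃) ≈-refl ≈-refl

  bracket-≃ : bracket ≃ ⟪ :bracketN ⟫ / ⟪ :1-3x :* :V :* :1-xγN ⟫
  bracket-≃ = ≃-normalise (:natᶠ 1 :/ᶠ :1-xγᶠ :+ᶠ :c₂*innerᶠ :-ᶠ :κᶠ :*ᶠ :xᶠ :-ᶠ :natᶠ 1) :1-xγN :bracketᶠ 1-xγN≢0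
    (≃-sub (≃-sub (≃-+ (≃-/ (≃-nat 1) 1-xγ-≃) c₂*inner-≃) (≃-* (≃-nat (suc k₁)) ≃-x)) (≃-nat 1)) ≈-refl ≈-refl

  prefactor-≃ : prefactor ≃ ⟪ :1-3x ⟫ / ⟪ :1+3X :x :* (con (+ 1) :- :x) ⟫
  prefactor-≃ = ≃-normalise (:1-3xᶠ :/ᶠ (:1+3xᶠ :*ᶠ :1-xᶠ)) (con (+ 1)) :prefactorᶠ one≢0 (≃-/ 1-3x-≃ (≃-* 1+3x-≃ 1-x-≃)) ≈-refl ≈-refl

  RHS-≃ : RHS (suc k₁) ≃ ⟪ :D ⟫ + ⟪ :bracketN ⟫ / ⟪ :D ⟫
  RHS-≃ = ≃-normalise (:natᶠ 1 :+ᶠ (:bracketN , :D)) (con (+ 1)) (:D :+ :bracketN , :D) one≢0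
    (≃-+ (≃-nat 1) (≃-normalise (:prefactorᶠ :*ᶠ :bracketᶠ) :1-3x (:bracketN , :D) 1-3X≢0 (≃-* prefactor-≃ bracket-≃) ≈-refl ≈-refl))
    ≈-refl ≈-refl

-- The argument works for every k ≥ 1; the hypothesis 2 ≤ k is only needed to exclude k = 0.
mainTheorem4 : (k : ℕ) → 2 ≤ k → cyclicGF k equalsFrac RHS k
mainTheorem4 (suc k₁) _ = NonZero⇒coeff≢0 den≢0 , coeff cyclicGF*den≈num
  where
  open ClosedForm k₁
  open RHS-representation k₁
  open _≃_/_ RHS-≃
  open ≈-Reasoning

  den≢0 : NonZero (den (RHS (suc k₁)))
  den≢0 = NonZero-resp-≈ (≈-sym den≈) (NonZero-* nonzero D≢0)

  cyclicGF*den≈num : cyclicGF (suc k₁) ⊗ den (RHS (suc k₁)) ≈ num (RHS (suc k₁))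
  cyclicGF*den≈num = begin
    cyclicGF (suc k₁) ⊗ den (RHS (suc k₁))   ≈⟨ ⊗≈* _ _ ⟩
    cyclicGF (suc k₁) * den (RHS (suc k₁))   ≈⟨ *-cong ≈-refl den≈ ⟩
    cyclicGF (suc k₁) * (factor * ⟪ :D ⟫)    ≈⟨ solve 3 (λ c z d → c :* (z :* d) := z :* (c :* d)) ≈-refl (cyclicGF (suc k₁)) factor ⟪ :D ⟫ ⟩
    factor * (cyclicGF (suc k₁) * ⟪ :D ⟫)    ≈⟨ *-cong ≈-refl cyclicGF*D ⟩
    factor * (⟪ :D ⟫ + ⟪ :bracketN ⟫)        ≈⟨ num≈ ⟨
    num (RHS (suc k₁))                       ∎
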